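{- Let $k[w,x,y,z]$ be the homogeneous coordinate ring of $\mathbf{P}^3$. Let $X$ be a set of five points in $\mathbf{P}^2$ in linearly general position, with defining ideals $I_1,\dots,I_5\subseteq k[x,y,z]$. Let $\tilde I_i=I_i\cdot k[w,x,y,z]$ and $I_{\mathcal{A}}=\tilde I_1\cap\dots\cap\tilde I_5$, so that $\mathcal{A}$ is the arrangement of five lines in $\mathbf{P}^3$ forming the cone over $X$. Then the three ideals $\tilde I_1\cdots\tilde I_5$, $F_{\mathcal{A},\tilde{\mathcal{H}}}$, and $I_{\mathcal{A}}$ are saturated and are pairwise different.
   Context: $k$ is an infinite field. Linearly general position means no three points are collinear. Here $\tilde{\mathcal{H}}$ is any central hyperplane arrangement in $k^4$ in which each line of $\mathcal{A}$ (as a 2-dimensional linear subspace) is an intersection of hyperplanes, and such that for every nonempty subset $\{i_1<\dots<i_t\}\subseteq\{1,\dots,5\}$ some subset of the linear forms defining the hyperplanes of $\tilde{\mathcal{H}}$ is a basis of the $k$-space of linear forms in $\tilde I_{i_1}\cap\dots\cap\tilde I_{i_t}$; with defining forms $m_1,\dots,m_s$, $F_{\mathcal{A},\tilde{\mathcal{H}}}=(m_{j_1}\cdots m_{j_q}\mid$ each $m_{j_u}\in\{m_1,\dots,m_s\}$ and for every $i$ some $m_{j_u}\in\tilde I_i)$. The saturation of a homogeneous ideal $I\subseteq k[w,x,y,z]$ is $\{f\mid f\cdot(w,x,y,z)^d\subseteq I \text{ for } d\gg0\}$, and $I$ is saturated if it equals its saturation. -}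

module Defs where

open import Level using (Level; _⊔_)
open import Algebra.Bundles using (CommutativeRing)
open import Data.Nat as ℕ using (ℕ; _≥_)
open import Data.Bool using (Bool; true; false; if_then_else_)
open import Data.Fin using (Fin)
open import Data.Fin.Subset using (Subset; _∈_)
import Data.Fin.Subset
open import Data.Vec as V using (Vec; []; _∷_; lookup)
import Data.Vec.Properties as VP
open import Data.List as L using (List; []; _∷_)
open import Data.List.Membership.Propositional as LM using ()
open import Data.Product using (Σ; ∃; _×_; _,_)
open import Relation.Nullary using (¬_)
open import Relation.Nullary.Decidable using (⌊_⌋)
open import Relation.Binary.PropositionalEquality using (_≡_; _≢_)

record IsField {c ℓ : Level} (R : CommutativeRing c ℓ) : Set (c ⊔ ℓ) where
  open CommutativeRing R
  field
    0≉1 : ¬ (0# ≈ 1#)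
    inverse : ∀ x → ¬ (x ≈ 0#) → ∃ λ y → (x * y) ≈ 1#

Infinite : {c ℓ : Level} (R : CommutativeRing c ℓ) → Set (c ⊔ ℓ)
Infinite R = ∃ λ (f : ℕ → Carrier) → ∀ a b → f a ≈ f b → a ≡ b
  where open CommutativeRing R

module Setup {c ℓ : Level} (R : CommutativeRing c ℓ) where
  open CommutativeRing R

  -- exponent vectors in the variables (w, x, y, z), in this order
  Mon : Set
  Mon = Vec ℕ 4

  -- a polynomial in k[w,x,y,z] as a finite formal sum of terms c·w^a x^b y^c z^d
  Poly : Set c
  Poly = List (Carrier × Mon)

  sumR : List Carrier → Carrier
  sumR = L.foldr _+_ 0#

  prodR : List Carrier → Carrier
  prodR = L.foldr _*_ 1#

  coeff : Poly → Mon → Carrier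
  coeff f m = sumR (L.map (λ { (a , e) → if ⌊ VP.≡-dec ℕ._≟_ e m ⌋ then a else 0# }) f)

  _≈P_ : Poly → Poly → Set ℓ
  f ≈P g = ∀ m → coeff f m ≈ coeff g m

  _+P_ : Poly → Poly → Poly
  f +P g = f L.++ g

  _*P_ : Poly → Poly → Poly
  f *P g = L.concatMap (λ { (a , e) → L.map (λ { (b , e′) → (a * b , V.zipWith ℕ._+_ e e′) }) g }) f

  0P 1P : Poly
  0P = []
  1P = (1# , 0 ∷ 0 ∷ 0 ∷ 0 ∷ []) ∷ []

  sumP : List Poly → Poly
  sumP = L.foldr _+P_ 0P

  prodP : List Poly → Poly
  prodP = L.foldr _*P_ 1P

  degree : Mon → ℕ
  degree = V.sum

  mono : Mon → Poly
  mono e = (1# , e) ∷ []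

  pow : Carrier → ℕ → Carrier
  pow a ℕ.zero = 1#
  pow a (ℕ.suc n) = a * pow a n

  eval : Poly → Vec Carrier 4 → Carrier
  eval f v = sumR (L.map (λ { (a , e) → a * prodR (V.toList (V.zipWith pow v e)) }) f)

  homog : ℕ → Poly → Poly
  homog d f = L.map (λ { (a , e) → ((if ⌊ degree e ℕ.≟ d ⌋ then a else 0#) , e) }) f

  Lin : Vec Carrier 4 → Poly
  Lin (a ∷ b ∷ d ∷ e ∷ []) =
    (a , 1 ∷ 0 ∷ 0 ∷ 0 ∷ []) ∷ (b , 0 ∷ 1 ∷ 0 ∷ 0 ∷ []) ∷
    (d , 0 ∷ 0 ∷ 1 ∷ 0 ∷ []) ∷ (e , 0 ∷ 0 ∷ 0 ∷ 1 ∷ []) ∷ []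

  dot : ∀ {n} → Vec Carrier n → Vec Carrier n → Carrier
  dot u v = V.foldr _ _+_ 0# (V.zipWith _*_ u v)

  IsZeroVec : ∀ {n} → Vec Carrier n → Set ℓ
  IsZeroVec v = ∀ i → lookup v i ≈ 0#

  PSet : (ℓ′ : Level) → Set (c ⊔ Level.suc ℓ′)
  PSet ℓ′ = Poly → Set ℓ′

  Gen : ∀ {ℓ′} → PSet ℓ′ → PSet (c ⊔ ℓ ⊔ ℓ′)
  Gen G f = Σ (List (Poly × Σ Poly G)) λ cs →
              f ≈P sumP (L.map (λ { (a , g , _) → a *P g }) cs)

  _≐_ : ∀ {ℓ₁ ℓ₂} → PSet ℓ₁ → PSet ℓ₂ → Set (c ⊔ ℓ₁ ⊔ ℓ₂)
  I ≐ J = ∀ f → (I f → J f) × (J f → I f)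

  -- polynomials not involving w (i.e. elements of k[x,y,z] ⊆ k[w,x,y,z])
  wFree : Poly → Set ℓ
  wFree f = ∀ m → V.head m ≢ 0 → coeff f m ≈ 0#

  -- defining ideal I(P) ⊆ k[x,y,z] of the point P = [p] ∈ P²: the homogeneous ideal
  -- of polynomials all of whose homogeneous components vanish at p
  PointIdeal : Vec Carrier 3 → PSet ℓ
  PointIdeal p f = wFree f × (∀ d → eval (homog d f) (0# ∷ p) ≈ 0#)

  Ext : ∀ {ℓ′} → PSet ℓ′ → PSet (c ⊔ ℓ ⊔ ℓ′)
  Ext = Gen

  ProdGens : ∀ {n ℓ′} → (Fin n → PSet ℓ′) → PSet (c ⊔ ℓ ⊔ ℓ′)
  ProdGens {n} J g = Σ (Fin n → Poly) λ f → (∀ i → J i (f i)) × (g ≈P prodP (L.map f (L.allFin n)))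

  ProdIdeal : ∀ {n ℓ′} → (Fin n → PSet ℓ′) → PSet (c ⊔ ℓ ⊔ ℓ′)
  ProdIdeal J = Gen (ProdGens J)

  InterIdeal : ∀ {n ℓ′} → (Fin n → PSet ℓ′) → PSet ℓ′
  InterIdeal J f = ∀ i → J i f

  -- 𝔪^d for 𝔪 = (w,x,y,z): generated by the monomials of degree d
  MonDeg : ℕ → PSet c
  MonDeg d g = Σ Mon λ e → degree e ≡ d × g ≡ mono e

  Saturation : ∀ {ℓ′} → PSet ℓ′ → PSet (c ⊔ ℓ ⊔ ℓ′)
  Saturation I f = ∃ λ d₀ → ∀ d → d ≥ d₀ → ∀ g → Gen (MonDeg d) g → I (f *P g)

  Saturated : ∀ {ℓ′} → PSet ℓ′ → Set (c ⊔ ℓ ⊔ ℓ′)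
  Saturated I = I ≐ Saturation I

  Zero : ∀ {ℓ′} → PSet ℓ′ → Vec Carrier 4 → Set (c ⊔ ℓ ⊔ ℓ′)
  Zero J v = ∀ f → J f → eval f v ≈ 0#

  Collinear : Vec Carrier 3 → Vec Carrier 3 → Vec Carrier 3 → Set (c ⊔ ℓ)
  Collinear a b d = Σ (Vec Carrier 3) λ l →
    ¬ IsZeroVec l × dot l a ≈ 0# × dot l b ≈ 0# × dot l d ≈ 0#

  GeneralPosition5 : (Fin 5 → Vec Carrier 3) → Set (c ⊔ ℓ)
  GeneralPosition5 p = (∀ i → ¬ IsZeroVec (p i)) ×
    (∀ i j k → i ≢ j → j ≢ k → i ≢ k → ¬ Collinear (p i) (p j) (p k))

  linComb : ∀ {s} → Subset s → (Fin s → Carrier) → (Fin s → Vec Carrier 4) → Vec Carrier 4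
  linComb {s} S cf m = L.foldr (λ j acc → V.zipWith _+_
      (if lookup S j then V.map (cf j *_) (m j) else V.replicate 4 0#) acc)
    (V.replicate 4 0#) (L.allFin s)

  IsBasisOfLinearFormsIn : ∀ {s ℓ′} → (Fin s → Vec Carrier 4) → Subset s → PSet ℓ′ → Set (c ⊔ ℓ ⊔ ℓ′)
  IsBasisOfLinearFormsIn m S J =
    (∀ j → j ∈ S → J (Lin (m j))) ×
    (∀ cf → IsZeroVec (linComb S cf m) → ∀ j → j ∈ S → cf j ≈ 0#) ×
    (∀ a → J (Lin a) → Σ (Fin _ → Carrier) λ cf → ∀ r → lookup a r ≈ lookup (linComb S cf m) r)

  module Arrangement (p : Fin 5 → Vec Carrier 3) {s : ℕ} (m : Fin s → Vec Carrier 4) where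
    Ĩ : Fin 5 → PSet (c ⊔ ℓ)
    Ĩ i = Ext (PointIdeal (p i))

    I𝒜 : PSet (c ⊔ ℓ)
    I𝒜 = InterIdeal Ĩ

    ProdĨ : PSet (c ⊔ ℓ)
    ProdĨ = ProdIdeal Ĩ

    Hyp : Fin s → Vec Carrier 4 → Set ℓ
    Hyp j v = dot (m j) v ≈ 0#

    -- hypotheses on the central arrangement ℋ̃ = {V(m₁),…,V(m_s)}
    IsAdmissible : Set (c ⊔ ℓ)
    IsAdmissible =
      (∀ j → ¬ IsZeroVec (m j)) ×
      -- each line of 𝒜 is an intersection of hyperplanes of ℋ̃
      (∀ i → Σ (Subset s) λ S → ∀ v →
         (Zero (Ĩ i) v → ∀ j → j ∈ S → Hyp j v) × ((∀ j → j ∈ S → Hyp j v) → Zero (Ĩ i) v)) ×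
      -- for every nonempty T ⊆ {1..5}, some subset of the mⱼ is a basis of the
      -- linear forms in ⋂_{i ∈ T} Ĩᵢ
      (∀ (T : Subset 5) → Data.Fin.Subset.Nonempty T → Σ (Subset s) λ S →
         IsBasisOfLinearFormsIn m S (λ f → ∀ i → i ∈ T → Ĩ i f))

    FGens : PSet (c ⊔ ℓ)
    FGens g = Σ (List (Fin s)) λ js →
      (∀ i → Σ (Fin s) λ u → u LM.∈ js × Ĩ i (Lin (m u))) ×
      (g ≈P prodP (L.map (λ j → Lin (m j)) js))

    F : PSet (c ⊔ ℓ)
    F = Gen FGens

{-# OPTIONS --safe #-}
-- The ideals Ĩᵢ, Ĩ₁⋯Ĩ₅ and F are generated by polynomials not involving w.  For F, split each
-- generator into the linear forms chosen to cover the five lines, which vanish at the vertex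
-- (1:0:0:0) of the cone and hence lie in k[x,y,z], times the remaining factors.  For such an ideal I,
-- division by a power of w is k[x,y,z]-linear, so f·wᵈ ∈ I forces f ∈ I; since wᵈ ∈ 𝔪ᵈ this gives
-- saturation, which passes to the intersection I_𝒜.  To separate the ideals compare orders at the
-- vertex: Ĩ₁⋯Ĩ₅ ⊆ 𝔪⁵, and F ⊆ 𝔪³ because a linear form vanishes on at most two of the lines (no three
-- of the points are collinear).  The conic through the five points lies in I_𝒜 but not in 𝔪³, and a
-- product of three forms of ℋ̃ vanishing on the line pairs {1,2}, {3,4}, {1,5} (they exist by the
-- basis condition) lies in F but not in 𝔪⁵; general position makes both nonzero at suitable points.
module Submission where

open import Defs
open import Level using (Level; _⊔_)
open import Algebra.Bundles using (CommutativeRing)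
open import Data.Bool using (Bool; true; false; if_then_else_)
open import Data.Empty using (⊥; ⊥-elim)
open import Data.Fin as Fin using (Fin; #_)
open import Data.Fin.Subset as Subset using (Subset; ⁅_⁆; _∪_; Nonempty)
open import Data.Fin.Subset.Properties using (nonempty?; x∈⁅x⁆; x∈⁅y⁆⇒x≡y; x∈p∪q⁺; x∈p∪q⁻)
open import Data.Integer as ℤ using (ℤ; +_; -[1+_]; _◃_)
import Data.Integer.Properties as ℤ
open import Data.List as L using (List; []; _∷_; _++_)
import Data.List.Properties as L
open import Data.List.Membership.Propositional using (_∈_)
open import Data.List.Membership.Propositional.Properties using (∈-map⁺; ∈-map⁻; ∈-allFin; ∈-filter⁺)
open import Data.List.Relation.Unary.All as All using (All; []; _∷_)
open import Data.List.Relation.Unary.All.Properties using (concat⁺; map⁺; ++⁺; all-filter)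
open import Data.List.Relation.Unary.Any using (here; there)
open import Data.Maybe using (just; nothing)
open import Data.Nat as ℕ using (ℕ; zero; suc; _≤_; z≤n; s≤s)
import Data.Nat.Properties as ℕ
open import Algebra.Properties.CommutativeSemigroup ℕ.+-commutativeSemigroup using () renaming (interchange to +-interchange)
open import Data.Product using (Σ; Σ-syntax; _×_; _,_; proj₁; proj₂)
import Data.Sign as Sign
open import Data.Sum using (_⊎_; inj₁; inj₂)
open import Data.Vec as V using (Vec; []; _∷_)
open import Data.Vec.Functional using () renaming (_∷_ to _∷ᶠ_)
import Data.Vec.Properties as VP
open import Function using (_∘_)
open import Relation.Binary.Definitions using (WeaklyDecidable)
open import Relation.Binary.PropositionalEquality as ≡ using (_≡_; _≢_)
open import Relation.Nullary using (¬_; Dec; yes; no; ¬?; contradiction)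
open import Relation.Nullary.Decidable using (False; toWitnessFalse; ¬¬-excluded-middle)
open import Relation.Unary using (Decidable; _⊆′_; _∩_)
open import Relation.Unary.Properties using (∁?)

-- The ring solver for R with coefficients in ℤ (through the canonical map ℤ → R): with coefficients
-- in R itself it could not cancel x - x, since equality in R is undecidable.
module IntegerCoefficientSolver {c ℓ : Level} (R : CommutativeRing c ℓ) where
  open CommutativeRing R
  open import Algebra.Properties.Ring ring using (-‿involutive; -0#≈0#; -‿+-comm; -‿distribˡ-*; -‿distribʳ-*)
  open import Algebra.Properties.Semiring.Mult.TCOptimised semiring using (×-homo-+; ×1-homo-*) renaming (_×_ to _·_)
  open import Algebra.Solver.Ring.AlmostCommutativeRing
    using (fromCommutativeRing; _-Raw-AlmostCommutative⟶_; Induced-equivalence)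
  open import Relation.Binary.Reasoning.Setoid setoid

  ℤ→R : ℤ → Carrier
  ℤ→R (+ n) = n · 1#
  ℤ→R -[1+ n ] = - (suc n · 1#)

  ℤ→R-neg : ∀ i → ℤ→R (ℤ.- i) ≈ - ℤ→R i
  ℤ→R-neg (+ 0) = sym -0#≈0#
  ℤ→R-neg (+ suc n) = refl
  ℤ→R-neg -[1+ n ] = sym (-‿involutive _)

  ℤ→R-⊖ : ∀ m n → ℤ→R (m ℤ.⊖ n) ≈ m · 1# - n · 1#
  ℤ→R-⊖ m n with ℕ.≤-total n m
  ... | inj₁ n≤m = begin
    ℤ→R (m ℤ.⊖ n)                   ≡⟨ ≡.cong ℤ→R (ℤ.⊖-≥ n≤m) ⟩
    k · 1#                          ≈⟨ +-identityʳ _ ⟨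
    k · 1# + 0#                     ≈⟨ +-congˡ (-‿inverseʳ _) ⟨
    k · 1# + (n · 1# - n · 1#)      ≈⟨ +-assoc _ _ _ ⟨
    (k · 1# + n · 1#) - n · 1#      ≈⟨ +-congʳ (trans (×-homo-+ 1# n k) (+-comm _ _)) ⟨
    (n ℕ.+ k) · 1# - n · 1#         ≡⟨ ≡.cong (λ j → j · 1# - n · 1#) (ℕ.m+[n∸m]≡n n≤m) ⟩
    m · 1# - n · 1#                 ∎
    where k = m ℕ.∸ n
  ... | inj₂ m≤n = begin
    ℤ→R (m ℤ.⊖ n)                   ≡⟨ ≡.cong ℤ→R (ℤ.⊖-≤ m≤n) ⟩
    ℤ→R (ℤ.- (+ k))                 ≈⟨ ℤ→R-neg (+ k) ⟩
    - (k · 1#)                      ≈⟨ +-identityˡ _ ⟨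
    0# - k · 1#                     ≈⟨ +-congʳ (-‿inverseʳ _) ⟨
    (m · 1# - m · 1#) - k · 1#      ≈⟨ +-assoc _ _ _ ⟩
    m · 1# + (- (m · 1#) - k · 1#)  ≈⟨ +-congˡ (-‿+-comm _ _) ⟩
    m · 1# - (m · 1# + k · 1#)      ≈⟨ +-congˡ (-‿cong (×-homo-+ 1# m k)) ⟨
    m · 1# - (m ℕ.+ k) · 1#         ≡⟨ ≡.cong (λ j → m · 1# - j · 1#) (ℕ.m+[n∸m]≡n m≤n) ⟩
    m · 1# - n · 1#                 ∎
    where k = n ℕ.∸ m

  ℤ→R-+ : ∀ i j → ℤ→R (i ℤ.+ j) ≈ ℤ→R i + ℤ→R j
  ℤ→R-+ (+ m) (+ n) = ×-homo-+ 1# m n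
  ℤ→R-+ (+ m) -[1+ n ] = ℤ→R-⊖ m (suc n)
  ℤ→R-+ -[1+ m ] (+ n) = trans (ℤ→R-⊖ n (suc m)) (+-comm _ _)
  ℤ→R-+ -[1+ m ] -[1+ n ] = begin
    - (suc (suc (m ℕ.+ n)) · 1#)        ≡⟨ ≡.cong (λ k → - (suc k · 1#)) (ℕ.+-suc m n) ⟨
    - ((suc m ℕ.+ suc n) · 1#)          ≈⟨ -‿cong (×-homo-+ 1# (suc m) (suc n)) ⟩
    - (suc m · 1# + suc n · 1#)         ≈⟨ -‿+-comm _ _ ⟨
    - (suc m · 1#) - suc n · 1#         ∎

  ℤ→R-* : ∀ i j → ℤ→R (i ℤ.* j) ≈ ℤ→R i * ℤ→R j
  ℤ→R-* (+ m) (+ n) = begin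
    ℤ→R (Sign.+ ◃ m ℕ.* n)              ≡⟨ ≡.cong ℤ→R (ℤ.+◃n≡+n (m ℕ.* n)) ⟩
    (m ℕ.* n) · 1#                       ≈⟨ ×1-homo-* m n ⟩
    m · 1# * n · 1#                      ∎
  ℤ→R-* (+ m) -[1+ n ] = begin
    ℤ→R (Sign.- ◃ m ℕ.* suc n)          ≡⟨ ≡.cong ℤ→R (ℤ.-◃n≡-n (m ℕ.* suc n)) ⟩
    ℤ→R (ℤ.- (+ (m ℕ.* suc n)))         ≈⟨ ℤ→R-neg (+ (m ℕ.* suc n)) ⟩
    - ((m ℕ.* suc n) · 1#)               ≈⟨ -‿cong (×1-homo-* m (suc n)) ⟩
    - (m · 1# * suc n · 1#)              ≈⟨ -‿distribʳ-* _ _ ⟩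
    m · 1# * - (suc n · 1#)              ∎
  ℤ→R-* -[1+ m ] (+ n) = begin
    ℤ→R (Sign.- ◃ suc m ℕ.* n)          ≡⟨ ≡.cong ℤ→R (ℤ.-◃n≡-n (suc m ℕ.* n)) ⟩
    ℤ→R (ℤ.- (+ (suc m ℕ.* n)))         ≈⟨ ℤ→R-neg (+ (suc m ℕ.* n)) ⟩
    - ((suc m ℕ.* n) · 1#)               ≈⟨ -‿cong (×1-homo-* (suc m) n) ⟩
    - (suc m · 1# * n · 1#)              ≈⟨ -‿distribˡ-* _ _ ⟩
    - (suc m · 1#) * n · 1#              ∎
  ℤ→R-* -[1+ m ] -[1+ n ] = begin
    ℤ→R (Sign.+ ◃ suc m ℕ.* suc n)      ≡⟨ ≡.cong ℤ→R (ℤ.+◃n≡+n (suc m ℕ.* suc n)) ⟩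
    (suc m ℕ.* suc n) · 1#               ≈⟨ ×1-homo-* (suc m) (suc n) ⟩
    a * b                                ≈⟨ -‿involutive _ ⟨
    - - (a * b)                          ≈⟨ -‿cong (-‿distribʳ-* a b) ⟩
    - (a * - b)                          ≈⟨ -‿distribˡ-* a (- b) ⟩
    - a * - b                            ∎
    where a = suc m · 1#; b = suc n · 1#

  ℤ→R-morphism : ℤ.+-*-rawRing -Raw-AlmostCommutative⟶ fromCommutativeRing R
  ℤ→R-morphism = record
    { ⟦_⟧ = ℤ→R ; +-homo = ℤ→R-+ ; *-homo = ℤ→R-* ; -‿homo = ℤ→R-neg ; 0-homo = refl ; 1-homo = refl }

  coefficient≟ : WeaklyDecidable (Induced-equivalence ℤ→R-morphism)
  coefficient≟ i j with i ℤ.≟ j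
  ... | yes ≡.refl = just refl
  ... | no _ = nothing

  open import Algebra.Solver.Ring ℤ.+-*-rawRing (fromCommutativeRing R) ℤ→R-morphism coefficient≟ public
    using (solve; _:=_; _:+_; _:*_; _:-_; :-_; con)

module Polynomials {c ℓ : Level} (R : CommutativeRing c ℓ) where
  open CommutativeRing R
  open Setup R
  open IntegerCoefficientSolver R
  open import Relation.Binary.Reasoning.Setoid setoid

  infixl 6 _+ₑ_
  _+ₑ_ : Mon → Mon → Mon
  _+ₑ_ = V.zipWith ℕ._+_

  OnExponents : ∀ {p} → (Mon → Set p) → Poly → Set (c ⊔ p)
  OnExponents P = All (P ∘ proj₂)

  everywhere : ∀ {p} {P : Mon → Set p} → (∀ e → P e) → ∀ f → OnExponents P f
  everywhere P f = All.universal (P ∘ proj₂) f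

  -- Every linear functional on k[w,x,y,z] is pair h for some h, and f ≈P g iff all of them agree
  -- on f and g.
  pair : (Mon → Carrier) → Poly → Carrier
  pair h [] = 0#
  pair h ((a , e) ∷ f) = a * h e + pair h f

  pair-congˡ : ∀ {h k} f → OnExponents (λ e → h e ≈ k e) f → pair h f ≈ pair k f
  pair-congˡ [] [] = refl
  pair-congˡ (_ ∷ f) (h≈k ∷ hs≈ks) = +-cong (*-congˡ h≈k) (pair-congˡ f hs≈ks)

  pair-zeroˡ : ∀ {h} f → OnExponents (λ e → h e ≈ 0#) f → pair h f ≈ 0#
  pair-zeroˡ [] [] = refl
  pair-zeroˡ ((a , _) ∷ f) (h≈0 ∷ hs≈0) = begin
    a * _ + pair _ f   ≈⟨ +-cong (trans (*-congˡ h≈0) (zeroʳ a)) (pair-zeroˡ f hs≈0) ⟩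
    0# + 0#            ≈⟨ +-identityˡ 0# ⟩
    0#                 ∎

  pair-+ˡ : ∀ h k f → pair (λ e → h e + k e) f ≈ pair h f + pair k f
  pair-+ˡ h k [] = sym (+-identityˡ 0#)
  pair-+ˡ h k ((a , e) ∷ f) = begin
    a * (h e + k e) + pair _ f                   ≈⟨ +-cong (distribˡ a (h e) (k e)) (pair-+ˡ h k f) ⟩
    (a * h e + a * k e) + (pair h f + pair k f)
      ≈⟨ solve 4 (λ x y z u → (x :+ y) :+ (z :+ u) := (x :+ z) :+ (y :+ u)) refl _ _ _ _ ⟩
    (a * h e + pair h f) + (a * k e + pair k f)  ∎

  pair-*ˡ : ∀ x h f → pair (λ e → x * h e) f ≈ x * pair h f
  pair-*ˡ x h [] = sym (zeroʳ x)
  pair-*ˡ x h ((a , e) ∷ f) = begin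
    a * (x * h e) + pair _ f       ≈⟨ +-cong (solve 3 (λ a x y → a :* (x :* y) := x :* (a :* y)) refl a x (h e)) (pair-*ˡ x h f) ⟩
    x * (a * h e) + x * pair h f   ≈⟨ distribˡ x _ _ ⟨
    x * (a * h e + pair h f)       ∎

  pair-++ : ∀ h f g → pair h (f ++ g) ≈ pair h f + pair h g
  pair-++ h [] g = sym (+-identityˡ _)
  pair-++ h ((a , e) ∷ f) g = trans (+-congˡ (pair-++ h f g)) (sym (+-assoc _ _ _))

  *P-∷ : ∀ t f g → (t ∷ f) *P g ≡ ((t ∷ []) *P g) ++ (f *P g)
  *P-∷ t f g = ≡.cong (_++ (f *P g)) (≡.sym (L.++-identityʳ _))

  pair-term-*P : ∀ h a e g → pair h (((a , e) ∷ []) *P g) ≈ a * pair (λ e′ → h (e +ₑ e′)) g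
  pair-term-*P h a e [] = sym (zeroʳ a)
  pair-term-*P h a e ((b , e′) ∷ g) = begin
    a * b * h (e +ₑ e′) + pair h (((a , e) ∷ []) *P g)  ≈⟨ +-cong (*-assoc a b _) (pair-term-*P h a e g) ⟩
    a * (b * h (e +ₑ e′)) + a * pair _ g  ≈⟨ distribˡ a _ _ ⟨
    a * (b * h (e +ₑ e′) + pair _ g)      ∎

  pair-*P : ∀ h f g → pair h (f *P g) ≈ pair (λ e → pair (λ e′ → h (e +ₑ e′)) g) f
  pair-*P h [] g = refl
  pair-*P h ((a , e) ∷ f) g = begin
    pair h (((a , e) ∷ f) *P g)                         ≡⟨ ≡.cong (pair h) (*P-∷ (a , e) f g) ⟩
    pair h ((((a , e) ∷ []) *P g) ++ (f *P g))          ≈⟨ pair-++ h (((a , e) ∷ []) *P g) (f *P g) ⟩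
    pair h (((a , e) ∷ []) *P g) + pair h (f *P g)      ≈⟨ +-cong (pair-term-*P h a e g) (pair-*P h f g) ⟩
    a * pair (λ e′ → h (e +ₑ e′)) g + pair _ f          ∎

  pair-swap : ∀ (k : Mon → Mon → Carrier) f g →
    pair (λ e → pair (k e) g) f ≈ pair (λ e′ → pair (λ e → k e e′) f) g
  pair-swap k [] g = sym (pair-zeroˡ g (everywhere (λ _ → refl) g))
  pair-swap k ((a , e) ∷ f) g = begin
    a * pair (k e) g + pair (λ e → pair (k e) g) f                ≈⟨ +-cong (pair-*ˡ a (k e) g) (sym (pair-swap k f g)) ⟨
    pair (λ e′ → a * k e e′) g + pair (λ e′ → pair (λ e → k e e′) f) g  ≈⟨ pair-+ˡ _ _ g ⟨
    pair (λ e′ → a * k e e′ + pair (λ e → k e e′) f) g             ∎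


  coeff-∷-≢ : ∀ {a e m} f → e ≢ m → coeff ((a , e) ∷ f) m ≈ coeff f m
  coeff-∷-≢ {e = e} {m} f e≢m with VP.≡-dec ℕ._≟_ e m
  ... | yes e≡m = contradiction e≡m e≢m
  ... | no _ = +-identityˡ _

  δ : Mon → Mon → Carrier
  δ m e with VP.≡-dec ℕ._≟_ e m
  ... | yes _ = 1#
  ... | no _ = 0#

  coeff≈pair-δ : ∀ f m → coeff f m ≈ pair (δ m) f
  coeff≈pair-δ [] m = refl
  coeff≈pair-δ ((a , e) ∷ f) m with VP.≡-dec ℕ._≟_ e m
  ... | yes _ = +-cong (sym (*-identityʳ a)) (coeff≈pair-δ f m)
  ... | no _ = +-cong (sym (zeroʳ a)) (coeff≈pair-δ f m)

  filterₑ : ∀ {p} {P : Mon → Set p} → Decidable P → Poly → Poly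
  filterₑ P? = L.filter (P? ∘ proj₂)

  module _ {p} {P : Mon → Set p} (P? : Decidable P) where

    coeff-filterₑ-∈ : ∀ {m} f → P m → coeff (filterₑ P? f) m ≈ coeff f m
    coeff-filterₑ-∈ [] _ = refl
    coeff-filterₑ-∈ {m} ((a , e) ∷ f) Pm with P? e
    ... | yes _ = +-congˡ (coeff-filterₑ-∈ f Pm)
    ... | no ¬Pe = trans (coeff-filterₑ-∈ f Pm) (sym (coeff-∷-≢ {a = a} f λ { ≡.refl → ¬Pe Pm }))

    coeff-filterₑ-∉ : ∀ {m} f → ¬ P m → coeff (filterₑ P? f) m ≈ 0#
    coeff-filterₑ-∉ [] _ = refl
    coeff-filterₑ-∉ {m} ((a , e) ∷ f) ¬Pm with P? e
    ... | yes Pe = trans (coeff-∷-≢ {a = a} (filterₑ P? f) λ { ≡.refl → ¬Pm Pe }) (coeff-filterₑ-∉ f ¬Pm)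
    ... | no _ = coeff-filterₑ-∉ f ¬Pm

  ≢-dec : (e : Mon) → Decidable (_≢ e)
  ≢-dec e e′ = ¬? (VP.≡-dec ℕ._≟_ e′ e)

  without : Mon → Poly → Poly
  without e = filterₑ (≢-dec e)

  without-cong : ∀ e {f g} → f ≈P g → without e f ≈P without e g
  without-cong e {f} {g} f≈g m with VP.≡-dec ℕ._≟_ m e
  ... | yes m≡e = trans (coeff-filterₑ-∉ (≢-dec e) f (λ m≢e → m≢e m≡e))
                        (sym (coeff-filterₑ-∉ (≢-dec e) g (λ m≢e → m≢e m≡e)))
  ... | no m≢e = trans (coeff-filterₑ-∈ (≢-dec e) f m≢e) (trans (f≈g m) (sym (coeff-filterₑ-∈ (≢-dec e) g m≢e)))

  length-without : ∀ e f → L.length (without e f) ≤ L.length f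
  length-without e = L.length-filter _

  length-without-∷ : ∀ a e f → L.length (without e ((a , e) ∷ f)) ≤ L.length f
  length-without-∷ a e f
    rewrite L.filter-reject (≢-dec e ∘ proj₂) {x = a , e} {xs = f} (λ e≢e → e≢e ≡.refl)
    = length-without e f

  pair-without : ∀ h e f → pair h f ≈ coeff f e * h e + pair h (without e f)
  pair-without h e [] = sym (trans (+-congʳ (zeroˡ _)) (+-identityˡ 0#))
  pair-without h e ((a , e′) ∷ f) with VP.≡-dec ℕ._≟_ e′ e
  ... | yes ≡.refl = begin
    a * h e + pair h f                                    ≈⟨ +-congˡ (pair-without h e f) ⟩
    a * h e + (coeff f e * h e + pair h (without e f))   ≈⟨ +-assoc _ _ _ ⟨
    (a * h e + coeff f e * h e) + pair h (without e f)   ≈⟨ +-congʳ (distribʳ (h e) a _) ⟨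
    (a + coeff f e) * h e + pair h (without e f)         ∎
  ... | no _ = begin
    a * h e′ + pair h f                                        ≈⟨ +-congˡ (pair-without h e f) ⟩
    a * h e′ + (coeff f e * h e + pair h (without e f))
      ≈⟨ solve 4 (λ x y u z → x :+ (y :* u :+ z) := (con (+ 0) :+ y) :* u :+ (x :+ z)) refl _ _ _ _ ⟩
    (0# + coeff f e) * h e + (a * h e′ + pair h (without e f)) ∎

  -- By induction on the total length: remove all terms with the exponent of some term of f or g.
  pair-cong : ∀ {f g} → f ≈P g → ∀ h → pair h f ≈ pair h g
  pair-cong {f} {g} = bounded (L.length f ℕ.+ L.length g) f g ℕ.≤-refl
    where
    bounded : ∀ n f g → L.length f ℕ.+ L.length g ≤ n → f ≈P g → ∀ h → pair h f ≈ pair h g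
    bounded n [] [] _ _ h = refl
    bounded zero (_ ∷ _) _ () _ _
    bounded zero [] (_ ∷ _) () _ _
    bounded (suc n) ((a , e) ∷ f) g (s≤s len) f≈g h = begin
      pair h ((a , e) ∷ f)                                      ≈⟨ pair-without h e ((a , e) ∷ f) ⟩
      coeff ((a , e) ∷ f) e * h e + pair h (without e ((a , e) ∷ f))
        ≈⟨ +-cong (*-congʳ (f≈g e)) (bounded n (without e ((a , e) ∷ f)) (without e g) shorter
                                              (without-cong e {(a , e) ∷ f} {g} f≈g) h) ⟩
      coeff g e * h e + pair h (without e g)                    ≈⟨ pair-without h e g ⟨
      pair h g                                                  ∎
      where shorter = ℕ.≤-trans (ℕ.+-mono-≤ (length-without-∷ a e f) (length-without e g)) len
    bounded (suc n) [] ((b , e) ∷ g) (s≤s len) f≈g h = begin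
      pair h []                                                 ≈⟨ pair-without h e [] ⟩
      coeff [] e * h e + pair h []
        ≈⟨ +-cong (*-congʳ (f≈g e)) (bounded n [] (without e ((b , e) ∷ g)) shorter
                                              (without-cong e {[]} {(b , e) ∷ g} f≈g) h) ⟩
      coeff ((b , e) ∷ g) e * h e + pair h (without e ((b , e) ∷ g))  ≈⟨ pair-without h e ((b , e) ∷ g) ⟨
      pair h ((b , e) ∷ g)                                      ∎
      where shorter = ℕ.≤-trans (length-without-∷ b e g) len

  -- Equivalent to ≈P; as a record it lets Agda infer the two polynomials.
  infix 4 _≃_
  record _≃_ (f g : Poly) : Set (c ⊔ ℓ) where
    constructor pairs≈
    field pair≈ : ∀ h → pair h f ≈ pair h g
  open _≃_ public

  ≃⇒≈P : ∀ {f g} → f ≃ g → f ≈P g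
  ≃⇒≈P {f} {g} (pairs≈ eq) m = trans (coeff≈pair-δ f m) (trans (eq (δ m)) (sym (coeff≈pair-δ g m)))

  ≈P⇒≃ : ∀ {f g} → f ≈P g → f ≃ g
  ≈P⇒≃ {f} {g} f≈g = pairs≈ (pair-cong {f} {g} f≈g)

  ≃-refl : ∀ {f} → f ≃ f
  ≃-refl = pairs≈ λ _ → refl

  ≃-reflexive : ∀ {f g} → f ≡ g → f ≃ g
  ≃-reflexive ≡.refl = ≃-refl

  ≃-sym : ∀ {f g} → f ≃ g → g ≃ f
  ≃-sym (pairs≈ eq) = pairs≈ λ h → sym (eq h)

  ≃-trans : ∀ {f g k} → f ≃ g → g ≃ k → f ≃ k
  ≃-trans (pairs≈ eq) (pairs≈ eq′) = pairs≈ λ h → trans (eq h) (eq′ h)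

  +P-cong : ∀ {f f′ g g′} → f ≃ f′ → g ≃ g′ → (f +P g) ≃ (f′ +P g′)
  +P-cong {f} {f′} {g} {g′} f≃f′ g≃g′ = pairs≈ λ h → begin
    pair h (f ++ g)           ≈⟨ pair-++ h f g ⟩
    pair h f + pair h g       ≈⟨ +-cong (pair≈ f≃f′ h) (pair≈ g≃g′ h) ⟩
    pair h f′ + pair h g′     ≈⟨ pair-++ h f′ g′ ⟨
    pair h (f′ ++ g′)         ∎

  *P-cong : ∀ {f f′ g g′} → f ≃ f′ → g ≃ g′ → (f *P g) ≃ (f′ *P g′)
  *P-cong {f} {f′} {g} {g′} f≃f′ g≃g′ = pairs≈ λ h → begin
    pair h (f *P g)                                 ≈⟨ pair-*P h f g ⟩
    pair (λ e → pair (λ e′ → h (e +ₑ e′)) g) f      ≈⟨ pair≈ f≃f′ _ ⟩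
    pair (λ e → pair (λ e′ → h (e +ₑ e′)) g) f′     ≈⟨ pair-congˡ f′ (everywhere (λ e → pair≈ g≃g′ _) f′) ⟩
    pair (λ e → pair (λ e′ → h (e +ₑ e′)) g′) f′    ≈⟨ pair-*P h f′ g′ ⟨
    pair h (f′ *P g′)                               ∎

  *P-congˡ : ∀ f {g g′} → g ≃ g′ → (f *P g) ≃ (f *P g′)
  *P-congˡ f = *P-cong (≃-refl {f})

  *P-congʳ : ∀ g {f f′} → f ≃ f′ → (f *P g) ≃ (f′ *P g)
  *P-congʳ g f≃f′ = *P-cong f≃f′ (≃-refl {g})

  *P-comm : ∀ f g → (f *P g) ≃ (g *P f)
  *P-comm f g = pairs≈ λ h → begin
    pair h (f *P g)                              ≈⟨ pair-*P h f g ⟩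
    pair (λ e → pair (λ e′ → h (e +ₑ e′)) g) f   ≈⟨ pair-swap (λ e e′ → h (e +ₑ e′)) f g ⟩
    pair (λ e′ → pair (λ e → h (e +ₑ e′)) f) g
      ≈⟨ pair-congˡ g (everywhere (λ e′ → pair-congˡ f (everywhere (λ e →
           reflexive (≡.cong h (VP.zipWith-comm ℕ.+-comm e e′))) f)) g) ⟩
    pair (λ e′ → pair (λ e → h (e′ +ₑ e)) f) g   ≈⟨ pair-*P h g f ⟨
    pair h (g *P f)                              ∎

  *P-assoc : ∀ f g k → ((f *P g) *P k) ≃ (f *P (g *P k))
  *P-assoc f g k = pairs≈ λ h → begin
    pair h ((f *P g) *P k)                                              ≈⟨ pair-*P h (f *P g) k ⟩
    pair (λ e → pair (λ e″ → h (e +ₑ e″)) k) (f *P g)                   ≈⟨ pair-*P _ f g ⟩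
    pair (λ e → pair (λ e′ → pair (λ e″ → h ((e +ₑ e′) +ₑ e″)) k) g) f
      ≈⟨ pair-congˡ f (everywhere (λ e → pair-congˡ g (everywhere (λ e′ → pair-congˡ k (everywhere (λ e″ →
           reflexive (≡.cong h (VP.zipWith-assoc ℕ.+-assoc e e′ e″))) k)) g)) f) ⟩
    pair (λ e → pair (λ e′ → pair (λ e″ → h (e +ₑ (e′ +ₑ e″))) k) g) f
      ≈⟨ pair-congˡ f (everywhere (λ e → pair-*P _ g k) f) ⟨
    pair (λ e → pair (λ e′ → h (e +ₑ e′)) (g *P k)) f                   ≈⟨ pair-*P h f (g *P k) ⟨
    pair h (f *P (g *P k))                                              ∎

  *P-distribʳ : ∀ f g k → ((f +P g) *P k) ≃ ((f *P k) +P (g *P k))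
  *P-distribʳ f g k = pairs≈ λ h → begin
    pair h ((f ++ g) *P k)                  ≈⟨ pair-*P h (f ++ g) k ⟩
    pair _ (f ++ g)                         ≈⟨ pair-++ _ f g ⟩
    pair _ f + pair _ g                     ≈⟨ +-cong (pair-*P h f k) (pair-*P h g k) ⟨
    pair h (f *P k) + pair h (g *P k)       ≈⟨ pair-++ h (f *P k) (g *P k) ⟨
    pair h ((f *P k) ++ (g *P k))           ∎

  *P-distribˡ : ∀ k f g → (k *P (f +P g)) ≃ ((k *P f) +P (k *P g))
  *P-distribˡ k f g =
    ≃-trans (*P-comm k (f +P g)) (≃-trans (*P-distribʳ f g k) (+P-cong (*P-comm f k) (*P-comm g k)))

  *P-zeroʳ : ∀ f → (f *P 0P) ≃ 0P
  *P-zeroʳ f = pairs≈ λ h → trans (pair-*P h f []) (pair-zeroˡ f (everywhere (λ _ → refl) f))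

  *P-identityˡ : ∀ f → (1P *P f) ≃ f
  *P-identityˡ f = pairs≈ λ h → begin
    pair h (1P *P f)                                     ≈⟨ pair-*P h 1P f ⟩
    1# * pair (λ e′ → h (V.replicate 4 0 +ₑ e′)) f + 0#  ≈⟨ trans (+-identityʳ _) (*-identityˡ _) ⟩
    pair (λ e′ → h (V.replicate 4 0 +ₑ e′)) f
      ≈⟨ pair-congˡ f (everywhere (λ e → reflexive (≡.cong h (VP.zipWith-identityˡ ℕ.+-identityˡ e))) f) ⟩
    pair h f                                             ∎

  monomialValue : Vec Carrier 4 → Mon → Carrier
  monomialValue v e = prodR (V.toList (V.zipWith pow v e))

  eval≈pair : ∀ f v → eval f v ≈ pair (monomialValue v) f
  eval≈pair [] v = refl
  eval≈pair ((a , e) ∷ f) v = +-congˡ (eval≈pair f v)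

  eval-cong : ∀ {f g} v → f ≃ g → eval f v ≈ eval g v
  eval-cong {f} {g} v f≃g = trans (eval≈pair f v) (trans (pair≈ f≃g _) (sym (eval≈pair g v)))

  pow-+ : ∀ x m n → pow x (m ℕ.+ n) ≈ pow x m * pow x n
  pow-+ x zero n = sym (*-identityˡ _)
  pow-+ x (suc m) n = trans (*-congˡ (pow-+ x m n)) (sym (*-assoc _ _ _))

  monomialValue-+ₑ : ∀ v e e′ → monomialValue v (e +ₑ e′) ≈ monomialValue v e * monomialValue v e′
  monomialValue-+ₑ (v₀ ∷ v₁ ∷ v₂ ∷ v₃ ∷ []) (a₀ ∷ a₁ ∷ a₂ ∷ a₃ ∷ []) (b₀ ∷ b₁ ∷ b₂ ∷ b₃ ∷ []) =
    trans (*-cong (pow-+ v₀ a₀ b₀) (*-cong (pow-+ v₁ a₁ b₁)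
                                           (*-cong (pow-+ v₂ a₂ b₂) (*-congʳ (pow-+ v₃ a₃ b₃)))))
          (solve 8 (λ x₀ y₀ x₁ y₁ x₂ y₂ x₃ y₃ →
                       x₀ :* y₀ :* (x₁ :* y₁ :* (x₂ :* y₂ :* (x₃ :* y₃ :* con (+ 1))))
                    := x₀ :* (x₁ :* (x₂ :* (x₃ :* con (+ 1)))) :* (y₀ :* (y₁ :* (y₂ :* (y₃ :* con (+ 1))))))
                 refl _ _ _ _ _ _ _ _)

  eval-+P : ∀ f g v → eval (f +P g) v ≈ eval f v + eval g v
  eval-+P f g v = begin
    eval (f ++ g) v                                        ≈⟨ eval≈pair (f ++ g) v ⟩
    pair (monomialValue v) (f ++ g)                        ≈⟨ pair-++ _ f g ⟩
    pair (monomialValue v) f + pair (monomialValue v) g    ≈⟨ +-cong (eval≈pair f v) (eval≈pair g v) ⟨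
    eval f v + eval g v                                    ∎

  eval-*P : ∀ f g v → eval (f *P g) v ≈ eval f v * eval g v
  eval-*P f g v = begin
    eval (f *P g) v                                                       ≈⟨ eval≈pair (f *P g) v ⟩
    pair V (f *P g)                                                       ≈⟨ pair-*P V f g ⟩
    pair (λ e → pair (λ e′ → V (e +ₑ e′)) g) f
      ≈⟨ pair-congˡ f (everywhere (λ e → pair-congˡ g (everywhere (monomialValue-+ₑ v e) g)) f) ⟩
    pair (λ e → pair (λ e′ → V e * V e′) g) f
      ≈⟨ pair-congˡ f (everywhere (λ e → pair-*ˡ (V e) V g) f) ⟩
    pair (λ e → V e * pair V g) f                                         ≈⟨ pair-congˡ f (everywhere (λ e → *-comm _ _) f) ⟩
    pair (λ e → pair V g * V e) f                                         ≈⟨ pair-*ˡ (pair V g) V f ⟩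
    pair V g * pair V f                                                   ≈⟨ *-comm _ _ ⟩
    pair V f * pair V g                                                   ≈⟨ *-cong (eval≈pair f v) (eval≈pair g v) ⟨
    eval f v * eval g v                                                   ∎
    where V = monomialValue v

  OnExponents-*P : ∀ {p q r} {P : Mon → Set p} {Q : Mon → Set q} {S : Mon → Set r} →
    (∀ {e e′} → P e → Q e′ → S (e +ₑ e′)) → ∀ {f g} → OnExponents P f → OnExponents Q g → OnExponents S (f *P g)
  OnExponents-*P PQ⇒S Pf Qg = concat⁺ (map⁺ (All.map (λ Pe → map⁺ (All.map (PQ⇒S Pe) Qg)) Pf))

  WFreeTerms : Poly → Set c
  WFreeTerms = OnExponents (λ e → V.head e ≡ 0)

  WFreeTerms-*P : ∀ {f g} → WFreeTerms f → WFreeTerms g → WFreeTerms (f *P g)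
  WFreeTerms-*P = OnExponents-*P λ { {_ ∷ _} {_ ∷ _} ≡.refl ≡.refl → ≡.refl }

  WFreeTerms-prodP : ∀ fs → All WFreeTerms fs → WFreeTerms (prodP fs)
  WFreeTerms-prodP [] [] = ≡.refl ∷ []
  WFreeTerms-prodP (f ∷ fs) (wf ∷ wfs) = WFreeTerms-*P wf (WFreeTerms-prodP fs wfs)

  Homogeneous : ℕ → Poly → Set c
  Homogeneous d = OnExponents (λ e → degree e ≡ d)

  degree-+ₑ : ∀ {n} (e e′ : Vec ℕ n) → V.sum (V.zipWith ℕ._+_ e e′) ≡ V.sum e ℕ.+ V.sum e′
  degree-+ₑ [] [] = ≡.refl
  degree-+ₑ (x ∷ e) (y ∷ e′) = ≡.trans (≡.cong ((x ℕ.+ y) ℕ.+_) (degree-+ₑ e e′)) (+-interchange x y _ _)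

  Homogeneous-*P : ∀ {a b f g} → Homogeneous a f → Homogeneous b g → Homogeneous (a ℕ.+ b) (f *P g)
  Homogeneous-*P = OnExponents-*P λ {e} {e′} e≡a e′≡b → ≡.trans (degree-+ₑ e e′) (≡.cong₂ ℕ._+_ e≡a e′≡b)

  module _ {a p} {X : Set a} {P : X → Set p} (P? : Decidable P) (φ : X → Poly) where

    prodP-partition : ∀ xs →
      prodP (L.map φ xs) ≃ (prodP (L.map φ (L.filter P? xs)) *P prodP (L.map φ (L.filter (∁? P?) xs)))
    prodP-partition [] = ≃-sym (*P-identityˡ 1P)
    prodP-partition (x ∷ xs) with P? x
    ... | yes _ = ≃-trans (*P-congˡ (φ x) (prodP-partition xs)) (≃-sym (*P-assoc (φ x) _ _))
    ... | no _ = ≃-trans (*P-congˡ (φ x) (prodP-partition xs)) (≃-trans (≃-sym (*P-assoc (φ x) A B))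
                   (≃-trans (*P-congʳ B (*P-comm (φ x) A)) (*P-assoc A (φ x) B)))
      where
      A = prodP (L.map φ (L.filter P? xs))
      B = prodP (L.map φ (L.filter (∁? P?) xs))

  All-map : ∀ {a p} {X : Set a} {P : Poly → Set p} (f : X → Poly) → (∀ x → P (f x)) → ∀ xs → All P (L.map f xs)
  All-map f Pf xs = map⁺ (All.universal Pf xs)

  prodP-map-cong : ∀ {a} {X : Set a} {φ ψ : X → Poly} xs → All (λ x → φ x ≃ ψ x) xs →
    prodP (L.map φ xs) ≃ prodP (L.map ψ xs)
  prodP-map-cong [] [] = ≃-refl
  prodP-map-cong (x ∷ xs) (φx≃ψx ∷ φ≃ψ) = *P-cong φx≃ψx (prodP-map-cong xs φ≃ψ)

  Lin₃ : Vec Carrier 3 → Poly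
  Lin₃ (l₀ ∷ l₁ ∷ l₂ ∷ []) =
    (l₀ , 0 ∷ 1 ∷ 0 ∷ 0 ∷ []) ∷ (l₁ , 0 ∷ 0 ∷ 1 ∷ 0 ∷ []) ∷ (l₂ , 0 ∷ 0 ∷ 0 ∷ 1 ∷ []) ∷ []

  WFreeTerms-Lin₃ : ∀ l → WFreeTerms (Lin₃ l)
  WFreeTerms-Lin₃ (_ ∷ _ ∷ _ ∷ []) = ≡.refl ∷ ≡.refl ∷ ≡.refl ∷ []

  Homogeneous-Lin₃ : ∀ l → Homogeneous 1 (Lin₃ l)
  Homogeneous-Lin₃ (_ ∷ _ ∷ _ ∷ []) = ≡.refl ∷ ≡.refl ∷ ≡.refl ∷ []

  Homogeneous-Lin : ∀ a → Homogeneous 1 (Lin a)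
  Homogeneous-Lin (_ ∷ _ ∷ _ ∷ _ ∷ []) = ≡.refl ∷ ≡.refl ∷ ≡.refl ∷ ≡.refl ∷ []

  Lin≃Lin₃ : ∀ a → V.head a ≈ 0# → Lin a ≃ Lin₃ (V.tail a)
  Lin≃Lin₃ (a₀ ∷ _ ∷ _ ∷ _ ∷ []) a₀≈0 =
    pairs≈ λ h → trans (+-congʳ (trans (*-congʳ a₀≈0) (zeroˡ _))) (+-identityˡ _)

  eval-Lin₃ : ∀ l t u → eval (Lin₃ l) (t ∷ u) ≈ dot l u
  eval-Lin₃ (l₀ ∷ l₁ ∷ l₂ ∷ []) t (u₀ ∷ u₁ ∷ u₂ ∷ []) = solve 7 (λ l₀ l₁ l₂ t u₀ u₁ u₂ →
         l₀ :* (I :* (u₀ :* I :* (I :* (I :* I))))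
      :+ (l₁ :* (I :* (I :* (u₁ :* I :* (I :* I))))
      :+ (l₂ :* (I :* (I :* (I :* (u₂ :* I :* I)))) :+ O))
    := l₀ :* u₀ :+ (l₁ :* u₁ :+ (l₂ :* u₂ :+ O))) refl l₀ l₁ l₂ t u₀ u₁ u₂
    where I = con (+ 1); O = con (+ 0)

  eval-Lin : ∀ a t u → eval (Lin a) (t ∷ u) ≈ V.head a * t + dot (V.tail a) u
  eval-Lin (a₀ ∷ l₀ ∷ l₁ ∷ l₂ ∷ []) t (u₀ ∷ u₁ ∷ u₂ ∷ []) = solve 8 (λ a₀ l₀ l₁ l₂ t u₀ u₁ u₂ →
         a₀ :* (t :* I :* (I :* (I :* (I :* I))))
      :+ (l₀ :* (I :* (u₀ :* I :* (I :* (I :* I))))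
      :+ (l₁ :* (I :* (I :* (u₁ :* I :* (I :* I))))
      :+ (l₂ :* (I :* (I :* (I :* (u₂ :* I :* I)))) :+ O)))
    := a₀ :* t :+ (l₀ :* u₀ :+ (l₁ :* u₁ :+ (l₂ :* u₂ :+ O)))) refl a₀ l₀ l₁ l₂ t u₀ u₁ u₂
    where I = con (+ 1); O = con (+ 0)

  monomialValue-one : ∀ v → monomialValue v (V.replicate 4 0) ≈ 1#
  monomialValue-one (v₀ ∷ v₁ ∷ v₂ ∷ v₃ ∷ []) =
    solve 4 (λ _ _ _ _ → con (+ 1) :* (con (+ 1) :* (con (+ 1) :* (con (+ 1) :* con (+ 1)))) := con (+ 1)) refl v₀ v₁ v₂ v₃

  degree≡0 : ∀ e → degree e ≡ 0 → e ≡ V.replicate 4 0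
  degree≡0 (0 ∷ 0 ∷ 0 ∷ 0 ∷ []) _ = ≡.refl

  const : Carrier → Poly
  const a = (a , V.replicate 4 0) ∷ []

  eval-const : ∀ a v → eval (const a) v ≈ a
  eval-const a v = trans (+-identityʳ _) (trans (*-congˡ (monomialValue-one v)) (*-identityʳ a))

  dropW : Poly → Poly
  dropW = filterₑ (λ e → V.head e ℕ.≟ 0)

  WFreeTerms-dropW : ∀ f → WFreeTerms (dropW f)
  WFreeTerms-dropW = all-filter ((λ e → V.head e ℕ.≟ 0) ∘ proj₂)

  wFree⇒≃dropW : ∀ f → wFree f → f ≃ dropW f
  wFree⇒≃dropW f wf = ≈P⇒≃ {f} {dropW f} λ m → coefficient m (V.head m ℕ.≟ 0)
    where
    coefficient : ∀ m → Dec (V.head m ≡ 0) → coeff f m ≈ coeff (dropW f) m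
    coefficient m (yes w∤m) = sym (coeff-filterₑ-∈ _ f w∤m)
    coefficient m (no w∣m) = trans (wf m w∣m) (sym (coeff-filterₑ-∉ _ f w∣m))

  WFreeTerms⇒wFree : ∀ {f} → WFreeTerms f → wFree f
  WFreeTerms⇒wFree [] m _ = refl
  WFreeTerms⇒wFree {(a , e) ∷ f} (w∤e ∷ wf) m w∣m =
    trans (coeff-∷-≢ {a = a} f λ { ≡.refl → w∣m w∤e }) (WFreeTerms⇒wFree wf m w∣m)

  eval-WFreeTerms : ∀ {f} t s u → WFreeTerms f → eval f (t ∷ u) ≈ eval f (s ∷ u)
  eval-WFreeTerms t s u [] = refl
  eval-WFreeTerms {(a , .0 ∷ e) ∷ f} t s u (≡.refl ∷ wf) = +-congˡ (eval-WFreeTerms t s u wf)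

  degreePart : ℕ → (Mon → Carrier) → Mon → Carrier
  degreePart d h e with degree e ℕ.≟ d
  ... | yes _ = h e
  ... | no _ = 0#

  degreePart-≡ : ∀ {d} h e → degree e ≡ d → degreePart d h e ≈ h e
  degreePart-≡ {d} h e e≡d with degree e ℕ.≟ d
  ... | yes _ = refl
  ... | no e≢d = contradiction e≡d e≢d

  degreePart-≢ : ∀ {d} h e → degree e ≢ d → degreePart d h e ≈ 0#
  degreePart-≢ {d} h e e≢d with degree e ℕ.≟ d
  ... | yes e≡d = contradiction e≡d e≢d
  ... | no _ = refl

  eval-homog : ∀ d f v → eval (homog d f) v ≈ pair (degreePart d (monomialValue v)) f
  eval-homog d [] v = refl
  eval-homog d ((a , e) ∷ f) v with degree e ℕ.≟ d
  ... | yes _ = +-congˡ (eval-homog d f v)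
  ... | no _ = +-cong (trans (zeroˡ _) (sym (zeroʳ a))) (eval-homog d f v)

  Σ≤ : ℕ → (ℕ → Carrier) → Carrier
  Σ≤ zero F = F 0
  Σ≤ (suc n) F = F (suc n) + Σ≤ n F

  Σ≤-zero : ∀ n F → (∀ d → d ≤ n → F d ≈ 0#) → Σ≤ n F ≈ 0#
  Σ≤-zero zero F F≈0 = F≈0 0 z≤n
  Σ≤-zero (suc n) F F≈0 =
    trans (+-cong (F≈0 (suc n) ℕ.≤-refl) (Σ≤-zero n F λ d d≤n → F≈0 d (ℕ.m≤n⇒m≤1+n d≤n))) (+-identityˡ 0#)

  Σ≤-degreePart : ∀ n h e → degree e ≤ n → Σ≤ n (λ d → degreePart d h e) ≈ h e
  Σ≤-degreePart zero h e e≤0 = degreePart-≡ h e (ℕ.n≤0⇒n≡0 e≤0)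
  Σ≤-degreePart (suc n) h e e≤1+n with degree e ℕ.≟ suc n
  ... | yes e≡1+n = trans (+-congˡ (Σ≤-zero n _ λ d d≤n → degreePart-≢ h e λ e≡d →
                          ℕ.<-irrefl ≡.refl (≡.subst (ℕ._≤ n) (≡.trans (≡.sym e≡d) e≡1+n) d≤n)))
                        (+-identityʳ _)
  ... | no e≢1+n = trans (+-congˡ (Σ≤-degreePart n h e (ℕ.≤-pred (ℕ.≤∧≢⇒< e≤1+n e≢1+n)))) (+-identityˡ _)

  pair-Σ≤ : ∀ n (H : ℕ → Mon → Carrier) f → pair (λ e → Σ≤ n (λ d → H d e)) f ≈ Σ≤ n (λ d → pair (H d) f)
  pair-Σ≤ zero H f = refl
  pair-Σ≤ (suc n) H f = trans (pair-+ˡ _ _ f) (+-congˡ (pair-Σ≤ n H f))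

  maxDegree : Poly → ℕ
  maxDegree [] = 0
  maxDegree ((_ , e) ∷ f) = degree e ℕ.⊔ maxDegree f

  maxDegree-bound : ∀ f → OnExponents (λ e → degree e ≤ maxDegree f) f
  maxDegree-bound [] = []
  maxDegree-bound ((_ , e) ∷ f) = ℕ.m≤m⊔n (degree e) (maxDegree f)
                                ∷ All.map (λ e≤ → ℕ.≤-trans e≤ (ℕ.m≤n⊔m (degree e) (maxDegree f))) (maxDegree-bound f)

  eval-Σ-homog : ∀ f v → eval f v ≈ Σ≤ (maxDegree f) (λ d → eval (homog d f) v)
  eval-Σ-homog f v = begin
    eval f v                                                          ≈⟨ eval≈pair f v ⟩
    pair (monomialValue v) f
      ≈⟨ pair-congˡ f (All.map (λ {t} → Σ≤-degreePart (maxDegree f) (monomialValue v) (proj₂ t)) (maxDegree-bound f)) ⟨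
    pair (λ e → Σ≤ (maxDegree f) (λ d → degreePart d (monomialValue v) e)) f  ≈⟨ pair-Σ≤ (maxDegree f) _ f ⟩
    Σ≤ (maxDegree f) (λ d → pair (degreePart d (monomialValue v)) f)
      ≈⟨ Σ≤-cong (maxDegree f) (λ d → eval-homog d f v) ⟨
    Σ≤ (maxDegree f) (λ d → eval (homog d f) v)                       ∎
    where
    Σ≤-cong : ∀ n {F G} → (∀ d → F d ≈ G d) → Σ≤ n F ≈ Σ≤ n G
    Σ≤-cong zero F≈G = F≈G 0
    Σ≤-cong (suc n) F≈G = +-cong (F≈G (suc n)) (Σ≤-cong n F≈G)

module Ideals {c ℓ : Level} (R : CommutativeRing c ℓ) where
  open CommutativeRing R
  open Setup R
  open Polynomials R
  open import Relation.Binary.Reasoning.Setoid setoid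

  record IsIdeal {ℓ′} (J : PSet ℓ′) : Set (c ⊔ ℓ ⊔ ℓ′) where
    field
      ≃-resp : ∀ {f g} → f ≃ g → J f → J g
      0P-mem : J 0P
      +P-closed : ∀ f g → J f → J g → J (f +P g)
      *P-closedˡ : ∀ a f → J f → J (a *P f)

    *P-closedʳ : ∀ f a → J f → J (f *P a)
    *P-closedʳ f a Jf = ≃-resp (*P-comm a f) (*P-closedˡ a f Jf)

  open IsIdeal public

  combination : ∀ {ℓ′} {G : PSet ℓ′} → List (Poly × Σ Poly G) → Poly
  combination cs = sumP (L.map (λ t → proj₁ t *P proj₁ (proj₂ t)) cs)

  module _ {ℓ′} {G : PSet ℓ′} where

    combination-++ : ∀ (cs ds : List (Poly × Σ Poly G)) → combination (cs ++ ds) ≡ combination cs +P combination ds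
    combination-++ [] ds = ≡.refl
    combination-++ ((a , g , _) ∷ cs) ds =
      ≡.trans (≡.cong ((a *P g) ++_) (combination-++ cs ds)) (≡.sym (L.++-assoc (a *P g) _ _))

    scaleCombination : Poly → List (Poly × Σ Poly G) → List (Poly × Σ Poly G)
    scaleCombination a = L.map (λ { (b , g) → a *P b , g })

    combination-*P : ∀ a (cs : List (Poly × Σ Poly G)) → (a *P combination cs) ≃ combination (scaleCombination a cs)
    combination-*P a [] = *P-zeroʳ a
    combination-*P a ((b , g , _) ∷ cs) =
      ≃-trans (*P-distribˡ a (b *P g) _) (+P-cong (≃-sym (*P-assoc a b g)) (combination-*P a cs))

    Gen-intro : ∀ {f} cs → f ≃ combination cs → Gen G f
    Gen-intro cs f≃cs = cs , ≃⇒≈P f≃cs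

    Gen-≃ : ∀ f (x : Gen G f) → f ≃ combination (proj₁ x)
    Gen-≃ f (cs , f≈cs) = ≈P⇒≃ {f} {combination cs} f≈cs

    Gen-isIdeal : IsIdeal (Gen G)
    Gen-isIdeal = record
      { ≃-resp = λ {f} f≃g Gf → Gen-intro (proj₁ Gf) (≃-trans (≃-sym f≃g) (Gen-≃ f Gf))
      ; 0P-mem = Gen-intro [] ≃-refl
      ; +P-closed = λ f g Gf Gg → Gen-intro (proj₁ Gf ++ proj₁ Gg)
          (≃-trans (+P-cong (Gen-≃ f Gf) (Gen-≃ g Gg)) (≃-reflexive (≡.sym (combination-++ (proj₁ Gf) (proj₁ Gg)))))
      ; *P-closedˡ = λ a f Gf → Gen-intro (scaleCombination a (proj₁ Gf))
          (≃-trans (*P-congˡ a (Gen-≃ f Gf)) (combination-*P a (proj₁ Gf)))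
      }

    Gen-generator : G ⊆′ Gen G
    Gen-generator g Gg = Gen-intro ((1P , g , Gg) ∷ [])
      (≃-sym (≃-trans (+P-cong (*P-identityˡ g) (≃-refl {[]})) (≃-reflexive (L.++-identityʳ g))))

    Gen-least : ∀ {ℓ″} {J : PSet ℓ″} → IsIdeal J → G ⊆′ J → Gen G ⊆′ J
    Gen-least {J = J} J-ideal G⊆J f Gf = ≃-resp J-ideal (≃-sym (Gen-≃ f Gf)) (combination∈ (proj₁ Gf))
      where
      combination∈ : ∀ cs → J (combination cs)
      combination∈ [] = 0P-mem J-ideal
      combination∈ ((a , g , Gg) ∷ cs) =
        +P-closed J-ideal (a *P g) _ (*P-closedˡ J-ideal a g (G⊆J g Gg)) (combination∈ cs)


  *P-preimage-isIdeal : ∀ {ℓ′} {J : PSet ℓ′} → IsIdeal J → ∀ b → IsIdeal (λ a → J (a *P b))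
  *P-preimage-isIdeal J-ideal b = record
    { ≃-resp = λ f≃g → ≃-resp J-ideal (*P-congʳ b f≃g)
    ; 0P-mem = 0P-mem J-ideal
    ; +P-closed = λ f g Jfb Jgb → ≃-resp J-ideal (≃-sym (*P-distribʳ f g b)) (+P-closed J-ideal _ _ Jfb Jgb)
    ; *P-closedˡ = λ a f Jfb → ≃-resp J-ideal (≃-sym (*P-assoc a f b)) (*P-closedˡ J-ideal a _ Jfb)
    }

  Gen-*P-Gen : ∀ {ℓ₁ ℓ₂ ℓ₃} {A : PSet ℓ₁} {B : PSet ℓ₂} {J : PSet ℓ₃} → IsIdeal J →
    (∀ x y → A x → B y → J (x *P y)) → ∀ a b → Gen A a → Gen B b → J (a *P b)
  Gen-*P-Gen {A = A} {J = J} J-ideal AB⊆J a b GenAa GenBb =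
    Gen-least (*P-preimage-isIdeal J-ideal b) generator-times a GenAa
    where
    generator-times : ∀ x → A x → J (x *P b)
    generator-times x Ax = ≃-resp J-ideal (*P-comm b x)
      (Gen-least (*P-preimage-isIdeal J-ideal x) (λ y By → ≃-resp J-ideal (*P-comm x y) (AB⊆J x y Ax By)) b GenBb)

  InterIdeal-isIdeal : ∀ {n ℓ′} {J : Fin n → PSet ℓ′} → (∀ i → IsIdeal (J i)) → IsIdeal (InterIdeal J)
  InterIdeal-isIdeal J-ideal = record
    { ≃-resp = λ f≃g Jf i → ≃-resp (J-ideal i) f≃g (Jf i)
    ; 0P-mem = λ i → 0P-mem (J-ideal i)
    ; +P-closed = λ f g Jf Jg i → +P-closed (J-ideal i) f g (Jf i) (Jg i)
    ; *P-closedˡ = λ a f Jf i → *P-closedˡ (J-ideal i) a f (Jf i)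
    }

  vanishing-isIdeal : ∀ v → IsIdeal (λ f → eval f v ≈ 0#)
  vanishing-isIdeal v = record
    { ≃-resp = λ f≃g fv≈0 → trans (sym (eval-cong v f≃g)) fv≈0
    ; 0P-mem = refl
    ; +P-closed = λ f g fv≈0 gv≈0 → trans (eval-+P f g v) (trans (+-cong fv≈0 gv≈0) (+-identityˡ 0#))
    ; *P-closedˡ = λ a f fv≈0 → trans (eval-*P a f v) (trans (*-congˡ fv≈0) (zeroʳ _))
    }

  Π : ∀ {n} → (Fin n → Poly) → Poly
  Π {n} f = prodP (L.map f (L.allFin n))

  Π-suc : ∀ {n} (f : Fin (suc n) → Poly) → Π f ≡ f Fin.zero *P Π (f ∘ Fin.suc)
  Π-suc f = ≡.cong (λ fs → f Fin.zero *P prodP fs)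
                   (≡.trans (L.map-tabulate Fin.suc f) (≡.sym (L.map-tabulate (λ i → i) (f ∘ Fin.suc))))

  ProdGens-Gen : ∀ {n ℓ₁ ℓ₂} {J : Fin n → PSet ℓ₁} {G : Fin n → PSet ℓ₂} →
    (∀ i → J i ⊆′ Gen (G i)) → ProdGens J ⊆′ Gen (ProdGens G)
  ProdGens-Gen {zero} _ g (f , _ , g≈1) = Gen-generator g (f , (λ ()) , g≈1)
  ProdGens-Gen {suc n} {J = J} {G} J⊆Gen g (f , Jf , g≈Πf) =
    ≃-resp Gen-isIdeal (≃-sym (≃-trans (≈P⇒≃ {g} {Π f} g≈Πf) (≃-reflexive (Π-suc f))))
      (Gen-*P-Gen Gen-isIdeal generators (f Fin.zero) (Π (f ∘ Fin.suc))
        (J⊆Gen Fin.zero _ (Jf Fin.zero))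
        (ProdGens-Gen (J⊆Gen ∘ Fin.suc) (Π (f ∘ Fin.suc)) (f ∘ Fin.suc , Jf ∘ Fin.suc , λ _ → refl)))
    where
    generators : ∀ x y → G Fin.zero x → ProdGens (G ∘ Fin.suc) y → Gen (ProdGens G) (x *P y)
    generators x y Gx (f′ , Gf′ , y≈Πf′) = Gen-generator (x *P y) (x ∷ᶠ f′ , G[x∷f′] ,
      ≃⇒≈P (≃-trans (*P-congˡ x (≈P⇒≃ {y} {Π f′} y≈Πf′)) (≃-reflexive (≡.sym (Π-suc (x ∷ᶠ f′))))))
      where
      G[x∷f′] : ∀ i → G i ((x ∷ᶠ f′) i)
      G[x∷f′] Fin.zero = Gx
      G[x∷f′] (Fin.suc i) = Gf′ i

  -- f ∈ 𝔪ⁿ, i.e. f has no monomials of degree < n, phrased through the functionals so that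
  -- it is invariant under ≃.
  𝔪^_ : ℕ → PSet (c ⊔ ℓ)
  (𝔪^ n) f = ∀ h → (∀ e → n ≤ degree e → h e ≈ 0#) → pair h f ≈ 0#

  𝔪^-*P : ∀ a b f g → (𝔪^ a) f → (𝔪^ b) g → (𝔪^ (a ℕ.+ b)) (f *P g)
  𝔪^-*P a b f g f∈𝔪ᵃ g∈𝔪ᵇ h h≈0 = trans (pair-*P h f g) (f∈𝔪ᵃ _ λ e a≤e → g∈𝔪ᵇ _ λ e′ b≤e′ →
    h≈0 (e +ₑ e′) (≡.subst (a ℕ.+ b ≤_) (≡.sym (degree-+ₑ e e′)) (ℕ.+-mono-≤ a≤e b≤e′)))

  𝔪^-zero : ∀ f → (𝔪^ 0) f
  𝔪^-zero f h h≈0 = pair-zeroˡ f (everywhere (λ e → h≈0 e z≤n) f)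

  𝔪^-anti : ∀ {m n} → m ≤ n → 𝔪^ n ⊆′ 𝔪^ m
  𝔪^-anti m≤n f f∈𝔪ⁿ h h≈0 = f∈𝔪ⁿ h λ e n≤e → h≈0 e (ℕ.≤-trans m≤n n≤e)

  𝔪^-isIdeal : ∀ n → IsIdeal (𝔪^ n)
  𝔪^-isIdeal n = record
    { ≃-resp = λ f≃g f∈𝔪ⁿ h h≈0 → trans (sym (pair≈ f≃g h)) (f∈𝔪ⁿ h h≈0)
    ; 0P-mem = λ _ _ → refl
    ; +P-closed = λ f g f∈𝔪ⁿ g∈𝔪ⁿ h h≈0 →
        trans (pair-++ h f g) (trans (+-cong (f∈𝔪ⁿ h h≈0) (g∈𝔪ⁿ h h≈0)) (+-identityˡ 0#))
    ; *P-closedˡ = λ a f → 𝔪^-*P 0 n a f (𝔪^-zero a)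
    }

  Homogeneous⇒𝔪^ : ∀ {d f} → Homogeneous d f → (𝔪^ d) f
  Homogeneous⇒𝔪^ {f = f} hom h h≈0 =
    pair-zeroˡ f (All.map (λ {t} deg≡d → h≈0 (proj₂ t) (ℕ.≤-reflexive (≡.sym deg≡d))) hom)

  below : ℕ → (Mon → Carrier) → Mon → Carrier
  below n h e with degree e ℕ.<? n
  ... | yes _ = h e
  ... | no _ = 0#

  𝔪^-homogeneous-vanishes : ∀ {d n f} → Homogeneous d f → d ℕ.< n → (𝔪^ n) f → ∀ v → eval f v ≈ 0#
  𝔪^-homogeneous-vanishes {d} {n} {f} hom d<n f∈𝔪ⁿ v = begin
    eval f v                            ≈⟨ eval≈pair f v ⟩
    pair (monomialValue v) f
      ≈⟨ pair-congˡ f (All.map (λ {t} deg≡d → below-< (proj₂ t) (≡.subst (ℕ._< n) (≡.sym deg≡d) d<n)) hom) ⟨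
    pair (below n (monomialValue v)) f  ≈⟨ f∈𝔪ⁿ _ below-≥ ⟩
    0#                                  ∎
    where
    below-< : ∀ e → degree e ℕ.< n → below n (monomialValue v) e ≈ monomialValue v e
    below-< e e<n with degree e ℕ.<? n
    ... | yes _ = refl
    ... | no e≮n = contradiction e<n e≮n
    below-≥ : ∀ e → n ≤ degree e → below n (monomialValue v) e ≈ 0#
    below-≥ e n≤e with degree e ℕ.<? n
    ... | yes e<n = contradiction n≤e (ℕ.<⇒≱ e<n)
    ... | no _ = refl

  prodP-𝔪 : ∀ fs → All (𝔪^ 1) fs → (𝔪^ L.length fs) (prodP fs)
  prodP-𝔪 [] [] = 𝔪^-zero 1P
  prodP-𝔪 (f ∷ fs) (f∈𝔪 ∷ fs∈𝔪) = 𝔪^-*P 1 _ f _ f∈𝔪 (prodP-𝔪 fs fs∈𝔪)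

  w^ : ℕ → Poly
  w^ D = mono (D ∷ 0 ∷ 0 ∷ 0 ∷ [])

  lowerW : ℕ → Mon → Mon
  lowerW D e = (V.head e ℕ.∸ D) ∷ V.tail e

  divW : ℕ → Poly → Poly
  divW D [] = []
  divW D ((a , e) ∷ f) with D ℕ.≤? V.head e
  ... | yes _ = (a , lowerW D e) ∷ divW D f
  ... | no _ = divW D f

  liftW : ℕ → (Mon → Carrier) → Mon → Carrier
  liftW D h e with D ℕ.≤? V.head e
  ... | yes _ = h (lowerW D e)
  ... | no _ = 0#

  pair-divW : ∀ D h f → pair h (divW D f) ≈ pair (liftW D h) f
  pair-divW D h [] = refl
  pair-divW D h ((a , e) ∷ f) with D ℕ.≤? V.head e
  ... | yes _ = +-congˡ (pair-divW D h f)
  ... | no _ = trans (pair-divW D h f) (sym (trans (+-congʳ (zeroʳ a)) (+-identityˡ _)))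

  divW-cong : ∀ D {f g} → f ≃ g → divW D f ≃ divW D g
  divW-cong D {f} {g} f≃g = pairs≈ λ h → trans (pair-divW D h f) (trans (pair≈ f≃g _) (sym (pair-divW D h g)))

  divW-+P : ∀ D f g → divW D (f +P g) ≃ (divW D f +P divW D g)
  divW-+P D f g = pairs≈ λ h → begin
    pair h (divW D (f ++ g))                          ≈⟨ pair-divW D h (f ++ g) ⟩
    pair (liftW D h) (f ++ g)                         ≈⟨ pair-++ _ f g ⟩
    pair (liftW D h) f + pair (liftW D h) g           ≈⟨ +-cong (pair-divW D h f) (pair-divW D h g) ⟨
    pair h (divW D f) + pair h (divW D g)             ≈⟨ pair-++ h (divW D f) (divW D g) ⟨
    pair h (divW D f ++ divW D g)                     ∎

  liftW-+ₑ : ∀ D h e e′ → V.head e′ ≡ 0 → liftW D h (e +ₑ e′) ≡ liftW D (λ x → h (x +ₑ e′)) e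
  liftW-+ₑ D h (e₀ ∷ e) (.0 ∷ e′) ≡.refl rewrite ℕ.+-identityʳ e₀ with D ℕ.≤? e₀
  ... | yes _ = ≡.cong (λ k → h (k ∷ V.zipWith ℕ._+_ e e′)) (≡.sym (ℕ.+-identityʳ (e₀ ℕ.∸ D)))
  ... | no _ = ≡.refl

  pair-liftW : ∀ D (H : Mon → Mon → Carrier) e g →
    pair (λ e′ → liftW D (λ x → H x e′) e) g ≈ liftW D (λ x → pair (H x) g) e
  pair-liftW D H e g with D ℕ.≤? V.head e
  ... | yes _ = refl
  ... | no _ = pair-zeroˡ g (everywhere (λ _ → refl) g)

  divW-*P : ∀ D a {g} → WFreeTerms g → divW D (a *P g) ≃ (divW D a *P g)
  divW-*P D a {g} wg = pairs≈ λ h → begin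
    pair h (divW D (a *P g))                                        ≈⟨ pair-divW D h (a *P g) ⟩
    pair (liftW D h) (a *P g)                                       ≈⟨ pair-*P _ a g ⟩
    pair (λ e → pair (λ e′ → liftW D h (e +ₑ e′)) g) a
      ≈⟨ pair-congˡ a (everywhere (λ e → pair-congˡ g
           (All.map (λ {t} w → reflexive (liftW-+ₑ D h e (proj₂ t) w)) wg)) a) ⟩
    pair (λ e → pair (λ e′ → liftW D (λ x → h (x +ₑ e′)) e) g) a
      ≈⟨ pair-congˡ a (everywhere (λ e → pair-liftW D _ e g) a) ⟩
    pair (liftW D (λ x → pair (λ e′ → h (x +ₑ e′)) g)) a           ≈⟨ pair-divW D _ a ⟨
    pair (λ x → pair (λ e′ → h (x +ₑ e′)) g) (divW D a)            ≈⟨ pair-*P h (divW D a) g ⟨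
    pair h (divW D a *P g)                                          ∎

  divW-w^ : ∀ D f → divW D (f *P w^ D) ≃ f
  divW-w^ D f = pairs≈ λ h → begin
    pair h (divW D (f *P w^ D))                          ≈⟨ pair-divW D h (f *P w^ D) ⟩
    pair (liftW D h) (f *P w^ D)                         ≈⟨ pair-*P _ f (w^ D) ⟩
    pair (λ e → 1# * liftW D h (e +ₑ (D ∷ 0 ∷ 0 ∷ 0 ∷ [])) + 0#) f
      ≈⟨ pair-congˡ f (everywhere (λ e → trans (+-identityʳ _) (trans (*-identityˡ _) (reflexive (liftW-w^ h e)))) f) ⟩
    pair h f                                             ∎
    where
    liftW-w^ : ∀ h e → liftW D h (e +ₑ (D ∷ 0 ∷ 0 ∷ 0 ∷ [])) ≡ h e
    liftW-w^ h (e₀ ∷ e₁ ∷ e₂ ∷ e₃ ∷ []) with D ℕ.≤? e₀ ℕ.+ D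
    ... | yes _ rewrite ℕ.m+n∸n≡m e₀ D | ℕ.+-identityʳ e₁ | ℕ.+-identityʳ e₂ | ℕ.+-identityʳ e₃ = ≡.refl
    ... | no D≰e₀+D = contradiction (ℕ.m≤n+m D e₀) D≰e₀+D

  Gen-divW : ∀ {ℓ′} {G : PSet ℓ′} → G ⊆′ WFreeTerms → ∀ D f → Gen G (f *P w^ D) → Gen G f
  Gen-divW {G = G} G⊆WFree D f Gfw =
    Gen-intro (divideCoefficients (proj₁ Gfw))
      (≃-trans (≃-sym (divW-w^ D f)) (≃-trans (divW-cong D (Gen-≃ (f *P w^ D) Gfw)) (divW-combination (proj₁ Gfw))))
    where
    divideCoefficients : List (Poly × Σ Poly G) → List (Poly × Σ Poly G)
    divideCoefficients = L.map (λ { (a , g) → divW D a , g })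

    divW-combination : ∀ cs → divW D (combination cs) ≃ combination (divideCoefficients cs)
    divW-combination [] = ≃-refl
    divW-combination ((a , g , Gg) ∷ cs) =
      ≃-trans (divW-+P D (a *P g) _) (+P-cong (divW-*P D a (G⊆WFree g Gg)) (divW-combination cs))

  WSaturated : ∀ {ℓ′} → PSet ℓ′ → Set (c ⊔ ℓ′)
  WSaturated J = ∀ D f → J (f *P w^ D) → J f

  WSaturated-generated : ∀ {ℓ′} {J : PSet ℓ′} → IsIdeal J → J ⊆′ Gen (WFreeTerms ∩ J) → WSaturated J
  WSaturated-generated J-ideal J⊆Gen D f Jfw =
    Gen-least J-ideal (λ _ → proj₂) f (Gen-divW (λ _ → proj₁) D f (J⊆Gen _ Jfw))

  WSaturated-InterIdeal : ∀ {n ℓ′} {J : Fin n → PSet ℓ′} → (∀ i → WSaturated (J i)) → WSaturated (InterIdeal J)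
  WSaturated-InterIdeal J-sat D f Jfw i = J-sat i D f (Jfw i)

  saturated : ∀ {ℓ′} {J : PSet ℓ′} → IsIdeal J → WSaturated J → Saturated J
  saturated J-ideal J-sat f = (λ Jf → 0 , λ _ _ g _ → *P-closedʳ J-ideal f g Jf)
                            , λ (d₀ , Jfg) → J-sat d₀ f (Jfg d₀ ℕ.≤-refl (w^ d₀) (Gen-generator (w^ d₀) (w^-MonDeg d₀)))
    where
    w^-MonDeg : ∀ d → MonDeg d (w^ d)
    w^-MonDeg d = (d ∷ 0 ∷ 0 ∷ 0 ∷ []) , ℕ.+-identityʳ d , ≡.refl

  module _ (p : Vec Carrier 3) where

    PointIdeal-vanishes : ∀ g → PointIdeal p g → eval g (0# ∷ p) ≈ 0#
    PointIdeal-vanishes g (_ , homog≈0) =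
      trans (eval-Σ-homog g (0# ∷ p)) (Σ≤-zero (maxDegree g) _ λ d _ → homog≈0 d)

    PointIdeal-vanishes-on-line : ∀ t g → PointIdeal p g → eval g (t ∷ p) ≈ 0#
    PointIdeal-vanishes-on-line t g g∈I@(wf , _) = begin
      eval g (t ∷ p)            ≈⟨ eval-cong (t ∷ p) (wFree⇒≃dropW g wf) ⟩
      eval (dropW g) (t ∷ p)    ≈⟨ eval-WFreeTerms t 0# p (WFreeTerms-dropW g) ⟩
      eval (dropW g) (0# ∷ p)   ≈⟨ eval-cong (0# ∷ p) (wFree⇒≃dropW g wf) ⟨
      eval g (0# ∷ p)           ≈⟨ PointIdeal-vanishes g g∈I ⟩
      0#                        ∎

    PointIdeal-𝔪 : ∀ g → PointIdeal p g → (𝔪^ 1) g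
    PointIdeal-𝔪 g (_ , homog≈0) h h≈0 = begin
      pair h g                                ≈⟨ pair-congˡ g (everywhere constantPart g) ⟩
      pair (λ e → h 𝟘 * degreePart 0 V e) g    ≈⟨ pair-*ˡ (h 𝟘) _ g ⟩
      h 𝟘 * pair (degreePart 0 V) g            ≈⟨ *-congˡ (trans (sym (eval-homog 0 g (0# ∷ p))) (homog≈0 0)) ⟩
      h 𝟘 * 0#                                 ≈⟨ zeroʳ _ ⟩
      0#                                       ∎
      where
      𝟘 = V.replicate 4 0
      V = monomialValue (0# ∷ p)
      constantPart : ∀ e → h e ≈ h 𝟘 * degreePart 0 V e
      constantPart e with degree e ℕ.≟ 0
      ... | yes e≡0 rewrite degree≡0 e e≡0 = sym (trans (*-congˡ (monomialValue-one (0# ∷ p))) (*-identityʳ _))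
      ... | no e≢0 = trans (h≈0 e (ℕ.n≢0⇒n>0 e≢0)) (sym (zeroʳ _))

    PointIdeal-intro : ∀ {d f} → Homogeneous d f → WFreeTerms f → eval f (0# ∷ p) ≈ 0# → PointIdeal p f
    PointIdeal-intro {d} {f} hom wf f≈0 = WFreeTerms⇒wFree wf , homog≈0
      where
      homog≈0 : ∀ d′ → eval (homog d′ f) (0# ∷ p) ≈ 0#
      homog≈0 d′ with d′ ℕ.≟ d
      ... | yes ≡.refl = begin
        eval (homog d′ f) (0# ∷ p)                         ≈⟨ eval-homog d′ f (0# ∷ p) ⟩
        pair (degreePart d′ (monomialValue (0# ∷ p))) f
          ≈⟨ pair-congˡ f (All.map (λ {t} → degreePart-≡ _ (proj₂ t)) hom) ⟩
        pair (monomialValue (0# ∷ p)) f                    ≈⟨ eval≈pair f (0# ∷ p) ⟨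
        eval f (0# ∷ p)                                    ≈⟨ f≈0 ⟩
        0#                                                 ∎
      ... | no d′≢d = trans (eval-homog d′ f (0# ∷ p)) (pair-zeroˡ f (All.map (λ {t} e≡d →
                        degreePart-≢ _ (proj₂ t) λ e≡d′ → d′≢d (≡.trans (≡.sym e≡d′) e≡d)) hom))

module PlaneGeometry {c ℓ : Level} (R : CommutativeRing c ℓ) where
  open CommutativeRing R
  open Setup R
  open IntegerCoefficientSolver R
  open import Algebra.Properties.Ring ring using (-0#≈0#)
  open import Relation.Binary.Reasoning.Setoid setoid

  cross : Vec Carrier 3 → Vec Carrier 3 → Vec Carrier 3
  cross (a₀ ∷ a₁ ∷ a₂ ∷ []) (b₀ ∷ b₁ ∷ b₂ ∷ []) =
    (a₁ * b₂ - a₂ * b₁) ∷ (a₂ * b₀ - a₀ * b₂) ∷ (a₀ * b₁ - a₁ * b₀) ∷ []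

  det : Vec Carrier 3 → Vec Carrier 3 → Vec Carrier 3 → Carrier
  det a b d = dot (cross a b) d

  det-repeat₁ : ∀ a b → det a b a ≈ 0#
  det-repeat₁ (a₀ ∷ a₁ ∷ a₂ ∷ []) (b₀ ∷ b₁ ∷ b₂ ∷ []) = solve 6 (λ a₀ a₁ a₂ b₀ b₁ b₂ →
         (a₁ :* b₂ :- a₂ :* b₁) :* a₀
      :+ ((a₂ :* b₀ :- a₀ :* b₂) :* a₁ :+ ((a₀ :* b₁ :- a₁ :* b₀) :* a₂ :+ con (+ 0)))
    := con (+ 0)) refl a₀ a₁ a₂ b₀ b₁ b₂

  det-repeat₂ : ∀ a b → det a b b ≈ 0#
  det-repeat₂ (a₀ ∷ a₁ ∷ a₂ ∷ []) (b₀ ∷ b₁ ∷ b₂ ∷ []) = solve 6 (λ a₀ a₁ a₂ b₀ b₁ b₂ →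
         (a₁ :* b₂ :- a₂ :* b₁) :* b₀
      :+ ((a₂ :* b₀ :- a₀ :* b₂) :* b₁ :+ ((a₀ :* b₁ :- a₁ :* b₀) :* b₂ :+ con (+ 0)))
    := con (+ 0)) refl a₀ a₁ a₂ b₀ b₁ b₂

  det-swap : ∀ a b d → det a d b ≈ - det a b d
  det-swap (a₀ ∷ a₁ ∷ a₂ ∷ []) (b₀ ∷ b₁ ∷ b₂ ∷ []) (d₀ ∷ d₁ ∷ d₂ ∷ []) =
    solve 9 (λ a₀ a₁ a₂ b₀ b₁ b₂ d₀ d₁ d₂ →
           (a₁ :* d₂ :- a₂ :* d₁) :* b₀
        :+ ((a₂ :* d₀ :- a₀ :* d₂) :* b₁ :+ ((a₀ :* d₁ :- a₁ :* d₀) :* b₂ :+ con (+ 0)))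
      := :- (   (a₁ :* b₂ :- a₂ :* b₁) :* d₀
             :+ ((a₂ :* b₀ :- a₀ :* b₂) :* d₁ :+ ((a₀ :* b₁ :- a₁ :* b₀) :* d₂ :+ con (+ 0)))))
      refl a₀ a₁ a₂ b₀ b₁ b₂ d₀ d₁ d₂

  dot-zeroˡ : ∀ {l : Vec Carrier 3} u → IsZeroVec l → dot l u ≈ 0#
  dot-zeroˡ {l₀ ∷ l₁ ∷ l₂ ∷ []} (u₀ ∷ u₁ ∷ u₂ ∷ []) l≈0 = begin
    l₀ * u₀ + (l₁ * u₁ + (l₂ * u₂ + 0#))  ≈⟨ +-cong (*-congʳ (l≈0 (# 0))) (+-cong (*-congʳ (l≈0 (# 1)))
                                                                          (+-congʳ (*-congʳ (l≈0 (# 2))))) ⟩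
    0# * u₀ + (0# * u₁ + (0# * u₂ + 0#))
      ≈⟨ solve 3 (λ u₀ u₁ u₂ → O :* u₀ :+ (O :* u₁ :+ (O :* u₂ :+ O)) := O) refl u₀ u₁ u₂ ⟩
    0#                                    ∎
    where O = con (+ 0)

  cross-standard-zero : ∀ a → IsZeroVec (cross a (1# ∷ 0# ∷ 0# ∷ [])) → IsZeroVec (cross a (0# ∷ 1# ∷ 0# ∷ [])) →
    IsZeroVec a
  cross-standard-zero (a₀ ∷ a₁ ∷ a₂ ∷ []) z₀ z₁ Fin.zero =
    trans (solve 3 (λ a₀ a₁ a₂ → a₀ := a₀ :* con (+ 1) :- a₁ :* con (+ 0)) refl a₀ a₁ a₂) (z₁ (# 2))
  cross-standard-zero (a₀ ∷ a₁ ∷ a₂ ∷ []) z₀ z₁ (Fin.suc Fin.zero) =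
    trans (solve 3 (λ a₀ a₁ a₂ → a₁ := :- (a₀ :* con (+ 0) :- a₁ :* con (+ 1))) refl a₀ a₁ a₂)
          (trans (-‿cong (z₀ (# 2))) -0#≈0#)
  cross-standard-zero (a₀ ∷ a₁ ∷ a₂ ∷ []) z₀ z₁ (Fin.suc (Fin.suc Fin.zero)) =
    trans (solve 3 (λ a₀ a₁ a₂ → a₂ := a₂ :* con (+ 1) :- a₀ :* con (+ 0)) refl a₀ a₁ a₂) (z₀ (# 1))

  -- If det a b d ≈ 0 one of cross a b, cross a d, cross a e₀, cross a e₁ is a common normal
  -- (the last two because cross a b ≈ 0 ≈ cross a d), unless a ≈ 0.
  det-nonzero : ∀ {a b d} → ¬ IsZeroVec a → ¬ Collinear a b d → ¬ det a b d ≈ 0#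
  det-nonzero {a} {b} {d} a≢0 ¬abd det≈0 =
    normal (cross a b) (det-repeat₁ a b) (det-repeat₂ a b) det≈0 λ ab≈0 →
    normal (cross a d) (det-repeat₁ a d) (trans (det-swap a b d) (trans (-‿cong det≈0) -0#≈0#)) (det-repeat₂ a d) λ ad≈0 →
    normal (cross a e₀) (det-repeat₁ a e₀) (orthogonal ab≈0 e₀) (orthogonal ad≈0 e₀) λ ae₀≈0 →
    normal (cross a e₁) (det-repeat₁ a e₁) (orthogonal ab≈0 e₁) (orthogonal ad≈0 e₁) λ ae₁≈0 →
    a≢0 (cross-standard-zero a ae₀≈0 ae₁≈0)
    where
    e₀ = 1# ∷ 0# ∷ 0# ∷ []
    e₁ = 0# ∷ 1# ∷ 0# ∷ []
    normal : ∀ l → dot l a ≈ 0# → dot l b ≈ 0# → dot l d ≈ 0# → ¬ ¬ IsZeroVec l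
    normal l la lb ld ¬l≈0 = ¬¬-excluded-middle λ
      { (yes l≈0) → ¬l≈0 l≈0
      ; (no l≢0) → ¬abd (l , l≢0 , la , lb , ld) }
    orthogonal : ∀ {x} → IsZeroVec (cross a x) → ∀ y → det a y x ≈ 0#
    orthogonal {x} ax≈0 y = trans (det-swap a x y) (trans (-‿cong (dot-zeroˡ {cross a x} y ax≈0)) -0#≈0#)

  dot-+ : ∀ (l u v : Vec Carrier 3) → dot l (V.zipWith _+_ u v) ≈ dot l u + dot l v
  dot-+ (l₀ ∷ l₁ ∷ l₂ ∷ []) (u₀ ∷ u₁ ∷ u₂ ∷ []) (v₀ ∷ v₁ ∷ v₂ ∷ []) =
    solve 9 (λ l₀ l₁ l₂ u₀ u₁ u₂ v₀ v₁ v₂ →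
        l₀ :* (u₀ :+ v₀) :+ (l₁ :* (u₁ :+ v₁) :+ (l₂ :* (u₂ :+ v₂) :+ O))
      := l₀ :* u₀ :+ (l₁ :* u₁ :+ (l₂ :* u₂ :+ O)) :+ (l₀ :* v₀ :+ (l₁ :* v₁ :+ (l₂ :* v₂ :+ O))))
      refl l₀ l₁ l₂ u₀ u₁ u₂ v₀ v₁ v₂
    where O = con (+ 0)

module NonzeroElements {c ℓ : Level} (R : CommutativeRing c ℓ) where
  open CommutativeRing R
  open import Algebra.Properties.Ring ring using (-0#≈0#; -‿involutive)
  open import Relation.Binary.Reasoning.Setoid setoid

  -‿nonzero : ∀ {x} → ¬ x ≈ 0# → ¬ - x ≈ 0#
  -‿nonzero {x} x≢0 -x≈0 = x≢0 (trans (sym (-‿involutive x)) (trans (-‿cong -x≈0) -0#≈0#))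

  *-nonzero : IsField R → ∀ {x y} → ¬ x ≈ 0# → ¬ y ≈ 0# → ¬ x * y ≈ 0#
  *-nonzero isField {x} {y} x≢0 y≢0 xy≈0 with IsField.inverse isField x x≢0
  ... | x⁻¹ , xx⁻¹≈1 = y≢0 (begin
    y               ≈⟨ *-identityˡ y ⟨
    1# * y          ≈⟨ *-congʳ (trans (sym xx⁻¹≈1) (*-comm x x⁻¹)) ⟩
    x⁻¹ * x * y     ≈⟨ *-assoc x⁻¹ x y ⟩
    x⁻¹ * (x * y)   ≈⟨ *-congˡ xy≈0 ⟩
    x⁻¹ * 0#        ≈⟨ zeroʳ x⁻¹ ⟩
    0#              ∎)

ThreeAgree : (Fin 5 → Bool) → Set
ThreeAgree b = Σ[ i ∈ Fin 5 ] Σ[ j ∈ Fin 5 ] Σ[ k ∈ Fin 5 ] i ≢ j × j ≢ k × i ≢ k × b i ≡ b j × b j ≡ b k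

isHere : ∀ {a} {A : Set a} {x : A} {xs} → x ∈ xs → Bool
isHere (here _) = true
isHere (there _) = false

isHere-injective : ∀ {a} {A : Set a} {x y u v : A} (x∈ : x ∈ u ∷ v ∷ []) (y∈ : y ∈ u ∷ v ∷ []) →
  isHere x∈ ≡ isHere y∈ → x ≡ y
isHere-injective (here x≡u) (here y≡u) _ = ≡.trans x≡u (≡.sym y≡u)
isHere-injective (there (here x≡v)) (there (here y≡v)) _ = ≡.trans x≡v (≡.sym y≡v)

module _ (b : Fin 5 → Bool) where

  agreeing : ∀ i j k {v} {_ : False (i Fin.≟ j)} {_ : False (j Fin.≟ k)} {_ : False (i Fin.≟ k)} →
    b i ≡ v → b j ≡ v → b k ≡ v → ThreeAgree b
  agreeing i j k {_} {i≢j} {j≢k} {i≢k} bi bj bk =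
    i , j , k , toWitnessFalse i≢j , toWitnessFalse j≢k , toWitnessFalse i≢k , ≡.trans bi (≡.sym bj) , ≡.trans bj (≡.sym bk)

  three-agree : ThreeAgree b
  three-agree with b (# 0) in e₀ | b (# 1) in e₁ | b (# 2) in e₂ | b (# 3) in e₃ | b (# 4) in e₄
  ... | _     | _     | true  | true  | true  = agreeing (# 2) (# 3) (# 4) e₂ e₃ e₄
  ... | _     | _     | false | false | false = agreeing (# 2) (# 3) (# 4) e₂ e₃ e₄
  ... | true  | _     | true  | true  | false = agreeing (# 0) (# 2) (# 3) e₀ e₂ e₃
  ... | false | true  | true  | true  | false = agreeing (# 1) (# 2) (# 3) e₁ e₂ e₃
  ... | false | false | true  | true  | false = agreeing (# 0) (# 1) (# 4) e₀ e₁ e₄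
  ... | true  | _     | true  | false | true  = agreeing (# 0) (# 2) (# 4) e₀ e₂ e₄
  ... | false | true  | true  | false | true  = agreeing (# 1) (# 2) (# 4) e₁ e₂ e₄
  ... | false | false | true  | false | true  = agreeing (# 0) (# 1) (# 3) e₀ e₁ e₃
  ... | true  | _     | false | true  | true  = agreeing (# 0) (# 3) (# 4) e₀ e₃ e₄
  ... | false | true  | false | true  | true  = agreeing (# 1) (# 3) (# 4) e₁ e₃ e₄
  ... | false | false | false | true  | true  = agreeing (# 0) (# 1) (# 2) e₀ e₁ e₂
  ... | false | _     | false | false | true  = agreeing (# 0) (# 2) (# 3) e₀ e₂ e₃
  ... | true  | false | false | false | true  = agreeing (# 1) (# 2) (# 3) e₁ e₂ e₃
  ... | true  | true  | false | false | true  = agreeing (# 0) (# 1) (# 4) e₀ e₁ e₄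
  ... | false | _     | false | true  | false = agreeing (# 0) (# 2) (# 4) e₀ e₂ e₄
  ... | true  | false | false | true  | false = agreeing (# 1) (# 2) (# 4) e₁ e₂ e₄
  ... | true  | true  | false | true  | false = agreeing (# 0) (# 1) (# 3) e₀ e₁ e₃
  ... | false | _     | true  | false | false = agreeing (# 0) (# 3) (# 4) e₀ e₃ e₄
  ... | true  | false | true  | false | false = agreeing (# 1) (# 3) (# 4) e₁ e₃ e₄
  ... | true  | true  | true  | false | false = agreeing (# 0) (# 1) (# 2) e₀ e₁ e₂

module FivePoints {c ℓ : Level} (R : CommutativeRing c ℓ) (isField : IsField R)
  (p : Fin 5 → Vec (CommutativeRing.Carrier R) 3) (general : Setup.GeneralPosition5 R p)
  {s : ℕ} (m : Fin s → Vec (CommutativeRing.Carrier R) 4) (admissible : Setup.Arrangement.IsAdmissible R p m) where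

  open CommutativeRing R
  open Setup R
  open Arrangement p m
  open Polynomials R
  open Ideals R
  open PlaneGeometry R
  open NonzeroElements R
  open IntegerCoefficientSolver R
  open import Relation.Binary.Reasoning.Setoid setoid

  det-points-nonzero : ∀ {i j k} → i ≢ j → j ≢ k → i ≢ k → ¬ det (p i) (p j) (p k) ≈ 0#
  det-points-nonzero {i} i≢j j≢k i≢k = det-nonzero (proj₁ general i) (proj₂ general i _ _ i≢j j≢k i≢k)

  det≢0 : ∀ i j k {_ : False (i Fin.≟ j)} {_ : False (j Fin.≟ k)} {_ : False (i Fin.≟ k)} →
    ¬ det (p i) (p j) (p k) ≈ 0#
  det≢0 i j k {i≢j} {j≢k} {i≢k} = det-points-nonzero (toWitnessFalse i≢j) (toWitnessFalse j≢k) (toWitnessFalse i≢k)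

  Ĩ-vanishes-on-line : ∀ i t → Ĩ i ⊆′ (λ f → eval f (t ∷ p i) ≈ 0#)
  Ĩ-vanishes-on-line i t = Gen-least (vanishing-isIdeal (t ∷ p i)) (λ g → PointIdeal-vanishes-on-line (p i) t g)

  Ĩ⊆𝔪 : ∀ i → Ĩ i ⊆′ 𝔪^ 1
  Ĩ⊆𝔪 i = Gen-least (𝔪^-isIdeal 1) (PointIdeal-𝔪 (p i))

  Ĩ-generated : ∀ i → Ĩ i ⊆′ Gen (WFreeTerms ∩ Ĩ i)
  Ĩ-generated i = Gen-least Gen-isIdeal λ g g∈I → ≃-resp Gen-isIdeal (≃-sym (wFree⇒≃dropW g (proj₁ g∈I)))
    (Gen-generator (dropW g) (WFreeTerms-dropW g , ≃-resp Gen-isIdeal (wFree⇒≃dropW g (proj₁ g∈I)) (Gen-generator g g∈I)))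

  Lin₃∈Ĩ : ∀ i l → dot l (p i) ≈ 0# → Ĩ i (Lin₃ l)
  Lin₃∈Ĩ i l l⊥pᵢ = Gen-generator (Lin₃ l)
    (PointIdeal-intro (p i) (Homogeneous-Lin₃ l) (WFreeTerms-Lin₃ l) (trans (eval-Lin₃ l 0# (p i)) l⊥pᵢ))

  Lin∈Ĩ-dot : ∀ i a → Ĩ i (Lin a) → dot (V.tail a) (p i) ≈ 0#
  Lin∈Ĩ-dot i a a∈Ĩ = begin
    dot (V.tail a) (p i)                      ≈⟨ +-identityˡ _ ⟨
    0# + dot (V.tail a) (p i)                 ≈⟨ +-congʳ (zeroʳ (V.head a)) ⟨
    V.head a * 0# + dot (V.tail a) (p i)      ≈⟨ eval-Lin a 0# (p i) ⟨
    eval (Lin a) (0# ∷ p i)                   ≈⟨ Ĩ-vanishes-on-line i 0# (Lin a) a∈Ĩ ⟩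
    0#                                        ∎

  Lin∈Ĩ-head : ∀ i a → Ĩ i (Lin a) → V.head a ≈ 0#
  Lin∈Ĩ-head i a a∈Ĩ = begin
    a₀                    ≈⟨ solve 2 (λ a₀ d → a₀ := a₀ :* con (+ 1) :+ d :- d) refl a₀ d ⟩
    a₀ * 1# + d - d       ≈⟨ +-cong (trans (sym (eval-Lin a 1# (p i))) (Ĩ-vanishes-on-line i 1# (Lin a) a∈Ĩ))
                                    (-‿cong (Lin∈Ĩ-dot i a a∈Ĩ)) ⟩
    0# - 0#               ≈⟨ -‿inverseʳ 0# ⟩
    0#                    ∎
    where
    a₀ = V.head a
    d = dot (V.tail a) (p i)

  form-misses-third : ∀ u {i j k} → i ≢ j → j ≢ k → i ≢ k → Ĩ i (Lin (m u)) → Ĩ j (Lin (m u)) →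
    ¬ dot (V.tail (m u)) (p k) ≈ 0#
  form-misses-third u {i} {j} {k} i≢j j≢k i≢k u∈Ĩᵢ u∈Ĩⱼ u⊥pₖ = proj₂ general i j k i≢j j≢k i≢k
    (V.tail (m u) , tail≢0 (m u) (proj₁ admissible u) (Lin∈Ĩ-head i (m u) u∈Ĩᵢ) ,
     Lin∈Ĩ-dot i (m u) u∈Ĩᵢ , Lin∈Ĩ-dot j (m u) u∈Ĩⱼ , u⊥pₖ)
    where
    tail≢0 : ∀ (a : Vec Carrier 4) → ¬ IsZeroVec a → V.head a ≈ 0# → ¬ IsZeroVec (V.tail a)
    tail≢0 (_ ∷ _) a≢0 a₀≈0 t≈0 = a≢0 λ { Fin.zero → a₀≈0 ; (Fin.suc r) → t≈0 r }

  I𝒜-saturated : Saturated I𝒜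
  I𝒜-saturated = saturated (InterIdeal-isIdeal λ _ → Gen-isIdeal)
    (WSaturated-InterIdeal λ i → WSaturated-generated Gen-isIdeal (Ĩ-generated i))

  ProdĨ-generated : ProdĨ ⊆′ Gen (WFreeTerms ∩ ProdĨ)
  ProdĨ-generated = Gen-least Gen-isIdeal λ g g∈Π → Gen-least Gen-isIdeal wFreeProduct g (ProdGens-Gen Ĩ-generated g g∈Π)
    where
    wFreeProduct : ProdGens (λ i → WFreeTerms ∩ Ĩ i) ⊆′ Gen (WFreeTerms ∩ ProdĨ)
    wFreeProduct g (f , f∈ , g≈Πf) = ≃-resp Gen-isIdeal (≃-sym (≈P⇒≃ {g} {Π f} g≈Πf)) (Gen-generator (Π f)
      ( WFreeTerms-prodP _ (All-map f (λ i → proj₁ (f∈ i)) (L.allFin 5))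
      , Gen-generator (Π f) (f , proj₂ ∘ f∈ , λ _ → refl)))

  ProdĨ-saturated : Saturated ProdĨ
  ProdĨ-saturated = saturated Gen-isIdeal (WSaturated-generated Gen-isIdeal ProdĨ-generated)

  Covers : List (Fin s) → Set (c ⊔ ℓ)
  Covers js = ∀ i → Σ (Fin s) λ u → u ∈ js × Ĩ i (Lin (m u))

  F-generated : F ⊆′ Gen (WFreeTerms ∩ F)
  F-generated = Gen-least Gen-isIdeal wFreeFactor
    where
    wFreeFactor : FGens ⊆′ Gen (WFreeTerms ∩ F)
    wFreeFactor h (js , covers , h≈) =
      ≃-resp Gen-isIdeal (≃-sym h≃BA) (*P-closedˡ Gen-isIdeal B A (Gen-generator A (WFreeTerms-A , A∈F)))
      where
      open import Data.List.Membership.DecPropositional (Fin._≟_ {s}) using (_∈?_)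
      covering : List (Fin s)
      covering = L.map (proj₁ ∘ covers) (L.allFin 5)
      Covering? = _∈? covering
      A′ A B : Poly
      A′ = prodP (L.map (Lin ∘ m) (L.filter Covering? js))
      A = prodP (L.map (Lin₃ ∘ V.tail ∘ m) (L.filter Covering? js))
      B = prodP (L.map (Lin ∘ m) (L.filter (∁? Covering?) js))
      covering-head : ∀ {j} → j ∈ covering → V.head (m j) ≈ 0#
      covering-head j∈ with ∈-map⁻ (proj₁ ∘ covers) j∈
      ... | i , _ , ≡.refl = Lin∈Ĩ-head i (m (proj₁ (covers i))) (proj₂ (proj₂ (covers i)))
      A′≃A : A′ ≃ A
      A′≃A = prodP-map-cong _ (All.map (λ {j} j∈ → Lin≃Lin₃ (m j) (covering-head j∈)) (all-filter Covering? js))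
      A∈F : F A
      A∈F = ≃-resp Gen-isIdeal A′≃A (Gen-generator A′ (L.filter Covering? js , covers′ , λ _ → refl))
        where
        covers′ : Covers (L.filter Covering? js)
        covers′ i = proj₁ (covers i)
                  , ∈-filter⁺ Covering? (proj₁ (proj₂ (covers i))) (∈-map⁺ (proj₁ ∘ covers) (∈-allFin i))
                  , proj₂ (proj₂ (covers i))
      WFreeTerms-A : WFreeTerms A
      WFreeTerms-A = WFreeTerms-prodP _ (All-map (Lin₃ ∘ V.tail ∘ m) (WFreeTerms-Lin₃ ∘ V.tail ∘ m) (L.filter Covering? js))
      h≃BA : h ≃ (B *P A)
      h≃BA = ≃-trans (≈P⇒≃ {h} {prodP (L.map (Lin ∘ m) js)} h≈)
               (≃-trans (prodP-partition Covering? (Lin ∘ m) js) (≃-trans (*P-congʳ B A′≃A) (*P-comm A B)))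

  F-saturated : Saturated F
  F-saturated = saturated Gen-isIdeal (WSaturated-generated Gen-isIdeal F-generated)

  ProdĨ⊆𝔪⁵ : ProdĨ ⊆′ 𝔪^ 5
  ProdĨ⊆𝔪⁵ = Gen-least (𝔪^-isIdeal 5) λ g (f , f∈Ĩ , g≈Πf) →
    ≃-resp (𝔪^-isIdeal 5) (≃-sym (≈P⇒≃ {g} {Π f} g≈Πf))
      (prodP-𝔪 (L.map f (L.allFin 5)) (All-map f (λ i → Ĩ⊆𝔪 i (f i) (f∈Ĩ i)) (L.allFin 5)))

  no-form-through-three : ∀ u {i j k} → i ≢ j → j ≢ k → i ≢ k →
    Ĩ i (Lin (m u)) → Ĩ j (Lin (m u)) → ¬ Ĩ k (Lin (m u))
  no-form-through-three u i≢j j≢k i≢k u∈Ĩᵢ u∈Ĩⱼ u∈Ĩₖ =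
    form-misses-third u i≢j j≢k i≢k u∈Ĩᵢ u∈Ĩⱼ (Lin∈Ĩ-dot _ (m u) u∈Ĩₖ)

  covered-thrice : ∀ {js} (covers : Covers js) {i j k} → i ≢ j → j ≢ k → i ≢ k →
    proj₁ (covers i) ≡ proj₁ (covers j) → proj₁ (covers j) ≡ proj₁ (covers k) → ⊥
  covered-thrice covers {i} {j} {k} i≢j j≢k i≢k uᵢ≡uⱼ uⱼ≡uₖ =
    no-form-through-three (proj₁ (covers k)) i≢j j≢k i≢k
      (≡.subst (λ u → Ĩ i (Lin (m u))) (≡.trans uᵢ≡uⱼ uⱼ≡uₖ) (proj₂ (proj₂ (covers i))))
      (≡.subst (λ u → Ĩ j (Lin (m u))) uⱼ≡uₖ (proj₂ (proj₂ (covers j))))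
      (proj₂ (proj₂ (covers k)))

  covering-length : ∀ js → Covers js → 3 ≤ L.length js
  covering-length [] covers with covers (# 0)
  ... | _ , () , _
  covering-length (a ∷ []) covers = ⊥-elim (covered-thrice covers {# 0} {# 1} {# 2} (λ ()) (λ ()) (λ ())
    (≡.trans (only (# 0)) (≡.sym (only (# 1)))) (≡.trans (only (# 1)) (≡.sym (only (# 2)))))
    where
    only : ∀ i → proj₁ (covers i) ≡ a
    only i with covers i
    ... | _ , here u≡a , _ = u≡a
  covering-length (a ∷ b ∷ []) covers with three-agree (isHere ∘ proj₁ ∘ proj₂ ∘ covers)
  ... | i , j , k , i≢j , j≢k , i≢k , ij , jk = ⊥-elim (covered-thrice covers i≢j j≢k i≢k
    (isHere-injective (proj₁ (proj₂ (covers i))) (proj₁ (proj₂ (covers j))) ij)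
    (isHere-injective (proj₁ (proj₂ (covers j))) (proj₁ (proj₂ (covers k))) jk))
  covering-length (_ ∷ _ ∷ _ ∷ _) _ = s≤s (s≤s (s≤s z≤n))

  F⊆𝔪³ : F ⊆′ 𝔪^ 3
  F⊆𝔪³ = Gen-least (𝔪^-isIdeal 3) λ h (js , covers , h≈) →
    ≃-resp (𝔪^-isIdeal 3) (≃-sym (≈P⇒≃ {h} {prodP (L.map (Lin ∘ m) js)} h≈))
      (𝔪^-anti (≡.subst (3 ≤_) (≡.sym (L.length-map (Lin ∘ m) js)) (covering-length js covers)) (prodP (L.map (Lin ∘ m) js))
        (prodP-𝔪 (L.map (Lin ∘ m) js) (All-map (Lin ∘ m) (λ u → Homogeneous⇒𝔪^ (Homogeneous-Lin (m u))) js)))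

  linComb-empty : ∀ (S : Subset s) cf → ¬ Nonempty S → IsZeroVec (linComb S cf m)
  linComb-empty S cf S-empty = foldr-zero (L.allFin s)
    where
    step : Fin s → Vec Carrier 4 → Vec Carrier 4
    step j acc = V.zipWith _+_ (if V.lookup S j then V.map (cf j *_) (m j) else V.replicate 4 0#) acc
    foldr-zero : ∀ js → IsZeroVec (L.foldr step (V.replicate 4 0#) js)
    foldr-zero [] r = reflexive (VP.lookup-replicate r 0#)
    foldr-zero (j ∷ js) r with V.lookup S j in S[j]
    ... | true = contradiction (j , VP.lookup⇒[]= j S S[j]) S-empty
    ... | false = begin
      V.lookup (V.zipWith _+_ (V.replicate 4 0#) acc) r   ≡⟨ VP.lookup-zipWith _+_ r (V.replicate 4 0#) acc ⟩
      V.lookup (V.replicate 4 0#) r + V.lookup acc r      ≈⟨ +-cong (reflexive (VP.lookup-replicate r 0#)) (foldr-zero js r) ⟩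
      0# + 0#                                             ≈⟨ +-identityˡ 0# ⟩
      0#                                                  ∎
      where acc = L.foldr step (V.replicate 4 0#) js

  FormThrough : Fin 5 → Fin 5 → Set (c ⊔ ℓ)
  FormThrough i j = Σ (Fin s) λ u → Ĩ i (Lin (m u)) × Ĩ j (Lin (m u))

  form-through : ∀ {i j k} → i ≢ j → j ≢ k → i ≢ k → FormThrough i j
  form-through {i} {j} {k} i≢j j≢k i≢k = from-basis (proj₂ (proj₂ admissible) T (i , i∈T))
    where
    T = ⁅ i ⁆ ∪ ⁅ j ⁆
    i∈T = x∈p∪q⁺ (inj₁ (x∈⁅x⁆ i))
    j∈T = x∈p∪q⁺ (inj₂ (x∈⁅x⁆ j))
    l = cross (p i) (p j)
    l∈Ĩ : ∀ i′ → i′ Subset.∈ T → Ĩ i′ (Lin (0# ∷ l))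
    l∈Ĩ i′ i′∈T =
      ≃-resp Gen-isIdeal (≃-sym (Lin≃Lin₃ (0# ∷ l) refl)) (Lin₃∈Ĩ i′ l (l⊥ (x∈p∪q⁻ ⁅ i ⁆ ⁅ j ⁆ i′∈T)))
      where
      l⊥ : i′ Subset.∈ ⁅ i ⁆ ⊎ i′ Subset.∈ ⁅ j ⁆ → det (p i) (p j) (p i′) ≈ 0#
      l⊥ (inj₁ i′∈) rewrite x∈⁅y⁆⇒x≡y i i′∈ = det-repeat₁ (p i) (p j)
      l⊥ (inj₂ i′∈) rewrite x∈⁅y⁆⇒x≡y j i′∈ = det-repeat₂ (p i) (p j)
    from-basis : Σ (Subset s) (λ S → IsBasisOfLinearFormsIn m S (λ f → ∀ i′ → i′ Subset.∈ T → Ĩ i′ f)) →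
      FormThrough i j
    from-basis (S , S⊆T , _ , spans) with nonempty? S
    ... | yes (u , u∈S) = u , S⊆T u u∈S i i∈T , S⊆T u u∈S j j∈T
    ... | no S-empty = ⊥-elim (det-points-nonzero i≢j j≢k i≢k (dot-zeroˡ {l} (p k) l≈0))
      where
      l≈0 : IsZeroVec l
      l≈0 r with spans (0# ∷ l) l∈Ĩ
      ... | cf , 0∷l≈ = trans (0∷l≈ (Fin.suc r)) (linComb-empty S cf S-empty (Fin.suc r))

  p₀ p₁ p₂ p₃ p₄ : Vec Carrier 3
  p₀ = p (# 0)
  p₁ = p (# 1)
  p₂ = p (# 2)
  p₃ = p (# 3)
  p₄ = p (# 4)

  -- A member of the pencil of conics through p₀, …, p₃ spanned by the line pairs p₀p₁ ∪ p₂p₃ and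
  -- p₀p₂ ∪ p₁p₃, with the coefficients making it pass through p₄ as well.
  c₁ c₂ : Carrier
  c₁ = det p₀ p₂ p₄ * det p₁ p₃ p₄
  c₂ = - (det p₀ p₁ p₄ * det p₂ p₃ p₄)

  conic : Poly
  conic = (const c₁ *P (Lin₃ (cross p₀ p₁) *P Lin₃ (cross p₂ p₃)))
       +P (const c₂ *P (Lin₃ (cross p₀ p₂) *P Lin₃ (cross p₁ p₃)))

  eval-conic : ∀ u → eval conic (0# ∷ u) ≈ c₁ * (det p₀ p₁ u * det p₂ p₃ u) + c₂ * (det p₀ p₂ u * det p₁ p₃ u)
  eval-conic u = trans (eval-+P (const c₁ *P (Lin₃ (cross p₀ p₁) *P Lin₃ (cross p₂ p₃)))
                                (const c₂ *P (Lin₃ (cross p₀ p₂) *P Lin₃ (cross p₁ p₃))) v)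
                       (+-cong (term c₁ p₀ p₁ p₂ p₃) (term c₂ p₀ p₂ p₁ p₃))
    where
    v = 0# ∷ u
    term : ∀ c a b d e → eval (const c *P (Lin₃ (cross a b) *P Lin₃ (cross d e))) v ≈ c * (det a b u * det d e u)
    term c a b d e = trans (eval-*P (const c) (Lin₃ (cross a b) *P Lin₃ (cross d e)) v) (*-cong (eval-const c v)
      (trans (eval-*P (Lin₃ (cross a b)) (Lin₃ (cross d e)) v) (*-cong (eval-Lin₃ (cross a b) 0# u) (eval-Lin₃ (cross d e) 0# u))))

  conic-homogeneous : Homogeneous 2 conic
  conic-homogeneous = ++⁺ (term c₁ p₀ p₁ p₂ p₃) (term c₂ p₀ p₂ p₁ p₃)
    where
    term : ∀ c a b d e → Homogeneous 2 (const c *P (Lin₃ (cross a b) *P Lin₃ (cross d e)))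
    term c a b d e = Homogeneous-*P (≡.refl ∷ []) (Homogeneous-*P (Homogeneous-Lin₃ (cross a b)) (Homogeneous-Lin₃ (cross d e)))

  conic-WFreeTerms : WFreeTerms conic
  conic-WFreeTerms = ++⁺ (term c₁ p₀ p₁ p₂ p₃) (term c₂ p₀ p₂ p₁ p₃)
    where
    term : ∀ c a b d e → WFreeTerms (const c *P (Lin₃ (cross a b) *P Lin₃ (cross d e)))
    term c a b d e = WFreeTerms-*P (≡.refl ∷ []) (WFreeTerms-*P (WFreeTerms-Lin₃ (cross a b)) (WFreeTerms-Lin₃ (cross d e)))

  conic-vanishes : ∀ i → eval conic (0# ∷ p i) ≈ 0#
  conic-vanishes i = trans (eval-conic (p i)) (vanishes i)
    where
    terms≈0 : ∀ {x y z w} → x ≈ 0# ⊎ y ≈ 0# → z ≈ 0# ⊎ w ≈ 0# → c₁ * (x * y) + c₂ * (z * w) ≈ 0#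
    terms≈0 xy≈0 zw≈0 = trans (+-cong (trans (*-congˡ (product≈0 xy≈0)) (zeroʳ c₁))
                                      (trans (*-congˡ (product≈0 zw≈0)) (zeroʳ c₂))) (+-identityˡ 0#)
      where
      product≈0 : ∀ {x y} → x ≈ 0# ⊎ y ≈ 0# → x * y ≈ 0#
      product≈0 (inj₁ x≈0) = trans (*-congʳ x≈0) (zeroˡ _)
      product≈0 (inj₂ y≈0) = trans (*-congˡ y≈0) (zeroʳ _)
    vanishes : ∀ i → c₁ * (det p₀ p₁ (p i) * det p₂ p₃ (p i)) + c₂ * (det p₀ p₂ (p i) * det p₁ p₃ (p i)) ≈ 0#
    vanishes Fin.zero = terms≈0 (inj₁ (det-repeat₁ p₀ p₁)) (inj₁ (det-repeat₁ p₀ p₂))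
    vanishes (Fin.suc Fin.zero) = terms≈0 (inj₁ (det-repeat₂ p₀ p₁)) (inj₂ (det-repeat₁ p₁ p₃))
    vanishes (Fin.suc (Fin.suc Fin.zero)) = terms≈0 (inj₂ (det-repeat₁ p₂ p₃)) (inj₁ (det-repeat₂ p₀ p₂))
    vanishes (Fin.suc (Fin.suc (Fin.suc Fin.zero))) = terms≈0 (inj₂ (det-repeat₂ p₂ p₃)) (inj₂ (det-repeat₂ p₁ p₃))
    vanishes (Fin.suc (Fin.suc (Fin.suc (Fin.suc Fin.zero)))) =
      solve 4 (λ x y z w → (x :* y) :* (z :* w) :+ (:- (z :* w)) :* (x :* y) := con (+ 0)) refl
        (det p₀ p₂ p₄) (det p₁ p₃ p₄) (det p₀ p₁ p₄) (det p₂ p₃ p₄)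

  conic∈I𝒜 : I𝒜 conic
  conic∈I𝒜 i = Gen-generator conic (PointIdeal-intro (p i) conic-homogeneous conic-WFreeTerms (conic-vanishes i))

  conic-nonvanishing : ¬ eval conic (0# ∷ V.zipWith _+_ p₀ p₁) ≈ 0#
  conic-nonvanishing conic≈0 = *-nonzero isField c₂≢0 (*-nonzero isField (det≢0 (# 0) (# 2) (# 1)) (det≢0 (# 1) (# 3) (# 0))) (begin
    c₂ * (det p₀ p₂ p₁ * det p₁ p₃ p₀)                              ≈⟨ +-identityˡ _ ⟨
    0# + c₂ * (det p₀ p₂ p₁ * det p₁ p₃ p₀)
      ≈⟨ +-cong first≈0 (*-congˡ (*-cong second third)) ⟨
    c₁ * (det p₀ p₁ u * det p₂ p₃ u) + c₂ * (det p₀ p₂ u * det p₁ p₃ u)  ≈⟨ eval-conic u ⟨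
    eval conic (0# ∷ u)                                            ≈⟨ conic≈0 ⟩
    0#                                                             ∎)
    where
    u = V.zipWith _+_ p₀ p₁
    c₂≢0 = -‿nonzero (*-nonzero isField (det≢0 (# 0) (# 1) (# 4)) (det≢0 (# 2) (# 3) (# 4)))
    first≈0 : c₁ * (det p₀ p₁ u * det p₂ p₃ u) ≈ 0#
    first≈0 = trans (*-congˡ (trans (*-congʳ (trans (dot-+ (cross p₀ p₁) p₀ p₁)
                (trans (+-cong (det-repeat₁ p₀ p₁) (det-repeat₂ p₀ p₁)) (+-identityˡ 0#)))) (zeroˡ _))) (zeroʳ c₁)
    second : det p₀ p₂ u ≈ det p₀ p₂ p₁
    second = trans (dot-+ (cross p₀ p₂) p₀ p₁) (trans (+-congʳ (det-repeat₁ p₀ p₂)) (+-identityˡ _))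
    third : det p₁ p₃ u ≈ det p₁ p₃ p₀
    third = trans (dot-+ (cross p₁ p₃) p₀ p₁) (trans (+-congˡ (det-repeat₁ p₁ p₃)) (+-identityʳ _))

  conic∉𝔪³ : ¬ (𝔪^ 3) conic
  conic∉𝔪³ conic∈𝔪³ = conic-nonvanishing
    (𝔪^-homogeneous-vanishes conic-homogeneous (s≤s (s≤s (s≤s z≤n))) conic∈𝔪³ (0# ∷ V.zipWith _+_ p₀ p₁))

  module Cubic (l₀₁ : FormThrough (# 0) (# 1)) (l₂₃ : FormThrough (# 2) (# 3)) (l₀₄ : FormThrough (# 0) (# 4)) where

    forms : List (Fin s)
    forms = proj₁ l₀₁ ∷ proj₁ l₂₃ ∷ proj₁ l₀₄ ∷ []

    a₀₁ a₂₃ a₀₄ : Vec Carrier 4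
    a₀₁ = m (proj₁ l₀₁)
    a₂₃ = m (proj₁ l₂₃)
    a₀₄ = m (proj₁ l₀₄)

    cubic : Poly
    cubic = prodP (L.map (Lin ∘ m) forms)

    cubic∈F : F cubic
    cubic∈F = Gen-generator cubic (forms , covers , λ _ → refl)
      where
      covers : Covers forms
      covers Fin.zero = proj₁ l₀₁ , here ≡.refl , proj₁ (proj₂ l₀₁)
      covers (Fin.suc Fin.zero) = proj₁ l₀₁ , here ≡.refl , proj₂ (proj₂ l₀₁)
      covers (Fin.suc (Fin.suc Fin.zero)) = proj₁ l₂₃ , there (here ≡.refl) , proj₁ (proj₂ l₂₃)
      covers (Fin.suc (Fin.suc (Fin.suc Fin.zero))) = proj₁ l₂₃ , there (here ≡.refl) , proj₂ (proj₂ l₂₃)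
      covers (Fin.suc (Fin.suc (Fin.suc (Fin.suc Fin.zero)))) = proj₁ l₀₄ , there (there (here ≡.refl)) , proj₂ (proj₂ l₀₄)

    cubic-homogeneous : Homogeneous 3 cubic
    cubic-homogeneous =
      Homogeneous-*P (Homogeneous-Lin a₀₁)
        (Homogeneous-*P (Homogeneous-Lin a₂₃) (Homogeneous-*P (Homogeneous-Lin a₀₄) (≡.refl ∷ [])))

    u : Vec Carrier 3
    u = V.zipWith _+_ p₀ p₂

    value : ∀ a → eval (Lin a) (0# ∷ u) ≈ dot (V.tail a) p₀ + dot (V.tail a) p₂
    value a = trans (eval-Lin a 0# u) (trans (+-congʳ (zeroʳ (V.head a))) (trans (+-identityˡ _) (dot-+ (V.tail a) p₀ p₂)))

    value-through-p₀ : ∀ {j} (l : FormThrough (# 0) j) → # 0 ≢ j → j ≢ # 2 → ¬ eval (Lin (m (proj₁ l))) (0# ∷ u) ≈ 0#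
    value-through-p₀ (v , v∈Ĩ₀ , v∈Ĩⱼ) 0≢j j≢2 v≈0 = form-misses-third v 0≢j j≢2 (λ ()) v∈Ĩ₀ v∈Ĩⱼ (begin
      dot (V.tail (m v)) p₂                            ≈⟨ +-identityˡ _ ⟨
      0# + dot (V.tail (m v)) p₂                       ≈⟨ +-congʳ (Lin∈Ĩ-dot (# 0) (m v) v∈Ĩ₀) ⟨
      dot (V.tail (m v)) p₀ + dot (V.tail (m v)) p₂    ≈⟨ value (m v) ⟨
      eval (Lin (m v)) (0# ∷ u)                        ≈⟨ v≈0 ⟩
      0#                                               ∎)

    value-through-p₂ : ¬ eval (Lin a₂₃) (0# ∷ u) ≈ 0#
    value-through-p₂ v≈0 =
      form-misses-third (proj₁ l₂₃) {k = # 0} (λ ()) (λ ()) (λ ()) (proj₁ (proj₂ l₂₃)) (proj₂ (proj₂ l₂₃)) (begin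
      dot (V.tail a₂₃) p₀                              ≈⟨ +-identityʳ _ ⟨
      dot (V.tail a₂₃) p₀ + 0#                         ≈⟨ +-congˡ (Lin∈Ĩ-dot (# 2) a₂₃ (proj₁ (proj₂ l₂₃))) ⟨
      dot (V.tail a₂₃) p₀ + dot (V.tail a₂₃) p₂        ≈⟨ value a₂₃ ⟨
      eval (Lin a₂₃) (0# ∷ u)                          ≈⟨ v≈0 ⟩
      0#                                               ∎)

    eval-cubic : eval cubic (0# ∷ u) ≈
      eval (Lin a₀₁) (0# ∷ u) * (eval (Lin a₂₃) (0# ∷ u) * (eval (Lin a₀₄) (0# ∷ u) * 1#))
    eval-cubic = trans (eval-*P (Lin a₀₁) _ v) (*-congˡ (trans (eval-*P (Lin a₂₃) (Lin a₀₄ *P 1P) v)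
                   (*-congˡ (trans (eval-*P (Lin a₀₄) 1P v) (*-congˡ (eval-const 1# v))))))
      where v = 0# ∷ u

    cubic-nonvanishing : ¬ eval cubic (0# ∷ u) ≈ 0#
    cubic-nonvanishing cubic≈0 = *-nonzero isField (value-through-p₀ l₀₁ (λ ()) (λ ()))
      (*-nonzero isField value-through-p₂ (*-nonzero isField (value-through-p₀ l₀₄ (λ ()) (λ ())) 1≢0))
      (trans (sym eval-cubic) cubic≈0)
      where
      1≢0 : ¬ 1# ≈ 0#
      1≢0 1≈0 = IsField.0≉1 isField (sym 1≈0)

    cubic∉𝔪⁵ : ¬ (𝔪^ 5) cubic
    cubic∉𝔪⁵ cubic∈𝔪⁵ =
      cubic-nonvanishing (𝔪^-homogeneous-vanishes cubic-homogeneous (s≤s (s≤s (s≤s (s≤s z≤n)))) cubic∈𝔪⁵ (0# ∷ u))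

  ProdĨ≉I𝒜 : ¬ (ProdĨ ≐ I𝒜)
  ProdĨ≉I𝒜 ProdĨ≐I𝒜 =
    conic∉𝔪³ (𝔪^-anti (s≤s (s≤s (s≤s z≤n))) conic (ProdĨ⊆𝔪⁵ conic (proj₂ (ProdĨ≐I𝒜 conic) conic∈I𝒜)))

  F≉I𝒜 : ¬ (F ≐ I𝒜)
  F≉I𝒜 F≐I𝒜 = conic∉𝔪³ (F⊆𝔪³ conic (proj₂ (F≐I𝒜 conic) conic∈I𝒜))

  ProdĨ≉F : ¬ (ProdĨ ≐ F)
  ProdĨ≉F ProdĨ≐F = cubic∉𝔪⁵ (ProdĨ⊆𝔪⁵ cubic (proj₂ (ProdĨ≐F cubic) cubic∈F))
    where
    open Cubic (form-through {k = # 2} (λ ()) (λ ()) (λ ())) (form-through {k = # 0} (λ ()) (λ ()) (λ ()))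
               (form-through {k = # 2} (λ ()) (λ ()) (λ ()))

proposition5p10 : ∀ {c ℓ : Level} (R : CommutativeRing c ℓ) → IsField R → Infinite R →
    let open CommutativeRing R using (Carrier) in
    (p : Fin 5 → Vec Carrier 3) → Setup.GeneralPosition5 R p →
    {s : ℕ} (m : Fin s → Vec Carrier 4) → Setup.Arrangement.IsAdmissible R p m →
    let open Setup R in
    let open Arrangement p m in
    (Saturated ProdĨ × Saturated F × Saturated I𝒜) ×
    (¬ (ProdĨ ≐ F) × ¬ (ProdĨ ≐ I𝒜) × ¬ (F ≐ I𝒜))
proposition5p10 R isField _ p general m admissible =
  (ProdĨ-saturated , F-saturated , I𝒜-saturated) , (ProdĨ≉F , ProdĨ≉I𝒜 , F≉I𝒜)
  where open FivePoints R isField p general m admissible
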